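{- Let $n$ be an odd, square-free, composite positive integer, and write $n=p_1p_2\cdots p_t$ with primes $p_1<p_2<\cdots<p_t$. Then, modulo $X^{p_2+2}$ (i.e. in $\mathbb{Z}[[X]]/(X^{p_2+2})$), $$\Phi_n(X)\equiv\begin{cases}\sum_{i=0}^{p_1-1}X^i - X^{p_2}-X^{p_2+1}, & \text{if } t \text{ is odd},\\[2pt] \sum_{i=0}^{\infty}X^{ip_1}-\sum_{i=0}^{\infty}X^{ip_1+1}+X^{p_2}-X^{p_2+1}, & \text{if } t \text{ is even}.\end{cases}$$
   Context: $\Phi_n(X)=\prod_{1\le m\le n,\ \gcd(m,n)=1}(X-e^{2\pi i m/n})\in\mathbb{Z}[X]$ is the $n$-th cyclotomic polynomial. The infinite sums are formal power series, only finitely many terms of which survive modulo $X^{p_2+2}$. -}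

module Defs where

open import Data.Bool using (Bool; true; false; if_then_else_)
open import Data.Nat as ℕ using (ℕ; zero; suc; _≡ᵇ_; _<_; _∸_)
open import Data.Nat.Divisibility using (_∣_; _∣?_)
open import Data.Integer as ℤ using (ℤ; +_; -_)
open import Data.List using (List; []; _∷_; map; foldr; filter; take; replicate; upTo; _++_; applyUpTo)
open import Relation.Binary.PropositionalEquality using (_≡_)

-- Polynomials over ℤ: coefficient lists, lowest degree first.
-- (Trailing zeros allowed; only coefficients matter.)

Poly : Set
Poly = List ℤ

coeff : Poly → ℕ → ℤ
coeff []       _       = + 0
coeff (a ∷ p) zero    = a
coeff (a ∷ p) (suc k) = coeff p k

infixl 6 _⊕_
infixl 7 _⊗_

_⊕_ : Poly → Poly → Poly
[]      ⊕ q       = q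
(a ∷ p) ⊕ []      = a ∷ p
(a ∷ p) ⊕ (b ∷ q) = (a ℤ.+ b) ∷ (p ⊕ q)

_⊗_ : Poly → Poly → Poly
[]      ⊗ q = []
(a ∷ p) ⊗ q = map (a ℤ.*_) q ⊕ (+ 0 ∷ (p ⊗ q))

monomial : ℕ → Poly
monomial m = replicate m (+ 0) ++ (+ 1 ∷ [])

xPowMinusOne : ℕ → Poly
xPowMinusOne m = monomial m ⊕ (- (+ 1) ∷ [])

-- Power-series inverse of g in ℤ[[X]], truncated to its first N
-- coefficients, valid whenever the constant term g₀ is a unit (±1),
-- using g₀⁻¹ = g₀:   h₀ = g₀,  h_k = - g₀ · Σ_{j=1}^{k} g_j h_{k-j}.

convTail : Poly → Poly → ℕ → ℤ
convTail g h k = foldr ℤ._+_ (+ 0) (map (λ j → coeff g (suc j) ℤ.* coeff h (k ∸ suc j)) (upTo k))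

invSeries : Poly → ℕ → Poly
invSeries g zero    = []
invSeries g (suc N) = hs ++ (next N ∷ [])
  where
  hs : Poly
  hs = invSeries g N
  g₀ : ℤ
  g₀ = coeff g 0
  next : ℕ → ℤ
  next zero    = g₀
  next (suc k) = - (g₀ ℤ.* convTail g hs (suc k))

-- Cyclotomic polynomials, via the defining relation
--   X^m - 1 = ∏_{d ∣ m} Φ_d(X),
-- i.e. Φ_m = (X^m - 1) / ∏_{d ∣ m, d < m} Φ_d (exact division in ℤ[X],
-- computed as a division in ℤ[[X]] by a series with constant term ±1 and
-- truncated to degree m ≥ deg Φ_m).

properDivisorProduct : ℕ → (ℕ → Poly) → Poly
properDivisorProduct m Φ =
  foldr _⊗_ (+ 1 ∷ []) (map Φ (filter (_∣? m) (applyUpTo suc (m ∸ 1))))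

newCyclotomic : ℕ → (ℕ → Poly) → Poly
newCyclotomic m Φ =
  take (suc m) (xPowMinusOne m ⊗ invSeries (properDivisorProduct m Φ) (suc m))

cyclotomicUpTo : ℕ → ℕ → Poly
cyclotomicUpTo zero    d = []
cyclotomicUpTo (suc k) d =
  if d ≡ᵇ suc k then newCyclotomic (suc k) (cyclotomicUpTo k) else cyclotomicUpTo k d

-- Φ_n, the n-th cyclotomic polynomial (n ≥ 1; Φ_0 is junk = 0)
cyclotomic : ℕ → Poly
cyclotomic n = cyclotomicUpTo n n

Series : Set
Series = ℕ → ℤ

toSeries : Poly → Series
toSeries = coeff

infixl 6 _+ₛ_ _-ₛ_

_+ₛ_ : Series → Series → Series
(f +ₛ g) k = f k ℤ.+ g k

_-ₛ_ : Series → Series → Series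
(f -ₛ g) k = f k ℤ.- g k

Xˢ : ℕ → Series
Xˢ e k = if e ≡ᵇ k then + 1 else + 0

finSum : ℕ → (ℕ → ℕ) → Series
finSum m e k = foldr ℤ._+_ (+ 0) (map (λ i → Xˢ (e i) k) (upTo m))

-- infinite formal sum  Σ_{i=0}^{∞} X^{e i}, for exponent maps with e i ≥ i
-- (so only the terms i ≤ k contribute to the coefficient of X^k)
infSum : (ℕ → ℕ) → Series
infSum e k = finSum (suc k) e k

_≡_mod-X^_ : Series → Series → ℕ → Set
f ≡ g mod-X^ N = ∀ k → k < N → f k ≡ g k

-- Work in ℤ[X]/(X^N) with N = p₂ + 2.  Every Φ_d has constant term ±1 and so is a unit there,
-- and the defining relation ∏_{d ∣ n} Φ_d = X^n - 1 becomes ∏_{d ∣ n} Φ_d ≡ -1 once n ≥ N.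
-- Comparing this relation for q m with the one for the divisors of m gives, by induction on m,
-- Φ_m Φ_{qm} ≡ 1 for every prime q ≥ N with q ∤ m > 1.  The primes p₃, …, p_t are odd and larger
-- than p₂, hence at least N, so Φ_n is Φ_{p₁p₂} or its inverse according to the parity of t.
-- Finally Φ_1 Φ_{p₁} Φ_{p₂} Φ_{p₁p₂} ≡ -1 with Φ_1 = X - 1 and Φ_p = 1 + ⋯ + X^{p-1} gives
-- Φ_{p₁p₂} ≡ (1 - X)(Σ_i X^{ip₁})(1 + X^{p₂}), whose inverse is (1 + ⋯ + X^{p₁-1})(1 - X^{p₂}).

{-# OPTIONS --safe #-}
module Submission where

open import Defs
open import Data.Nat using (ℕ; zero; suc; _+_; _*_; _∸_; _<_; _≤_; _≟_; z≤n; s≤s; NonZero; nonTrivial⇒n>1; >-nonZero)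
import Data.Nat.Properties as ℕ
open import Data.Nat.Divisibility
open import Data.Nat.DivMod using (_/_; m*[n/m]≡n; n/n≡1; m/n≡1+[m∸n]/n)
open import Data.Nat.Coprimality using (Coprime; coprime-divisor)
open import Data.Nat.Primality using (Prime; Composite; productOfPrimes≢0; prime⇒irreducible; prime⇒nonZero; prime⇒nonTrivial; euclidsLemma)
open import Data.Nat.ListAction using (product)
open import Data.Nat.ListAction.Properties using (∈⇒∣product)
open import Data.Nat.Induction using (<-rec)
open import Data.Integer as ℤ using (ℤ; +_; -_)
import Data.Integer.Properties as ℤ
open import Data.Integer.Tactic.RingSolver using (solve-∀)
open import Data.List using (List; []; _∷_; _++_; map; drop; foldr; filter; applyUpTo; take; replicate; length)
open import Data.List.Properties using (map-applyUpTo; length-++; length-replicate)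
open import Data.List.Relation.Unary.All as All using (All; []; _∷_)
open import Data.List.Relation.Unary.AllPairs using (AllPairs; _∷_)
open import Data.List.Relation.Unary.Linked using (Linked)
open import Data.List.Relation.Unary.Linked.Properties using (Linked⇒AllPairs)
open import Data.Product using (_×_; _,_)
open import Data.Sum using (_⊎_; inj₁; inj₂; [_,_]′)
open import Function using (id; _∘_; _⇔_; mk⇔; Equivalence; case_of_)
open import Level using (0ℓ)
open import Relation.Unary using (Pred; Decidable)
open import Relation.Nullary using (Dec; yes; no; ¬_; contradiction)
open import Relation.Nullary.Decidable using (dec-true; dec-false)
open import Relation.Binary.PropositionalEquality using (_≡_; _≢_; refl; sym; trans; cong; cong₂; subst; module ≡-Reasoning)
open import Algebra.Bundles using (CommutativeMonoid)
open import Algebra.Structures.Biased using (isCommutativeMonoidˡ)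
import Algebra.Properties.CommutativeSemigroup ℕ.*-commutativeSemigroup as ℕ*
import Algebra.Properties.CommutativeSemigroup ℤ.+-commutativeSemigroup as ℤ+

prime∤⇒coprime : ∀ {q d} → Prime q → ¬ q ∣ d → Coprime d q
prime∤⇒coprime q-prime q∤d (i∣d , i∣q) with prime⇒irreducible q-prime i∣q
... | inj₁ i≡1 = i≡1
... | inj₂ refl = contradiction i∣d q∤d

prime⇒≥2 : ∀ {p} → Prime p → 2 ≤ p
prime⇒≥2 {p} p-prime = nonTrivial⇒n>1 p {{prime⇒nonTrivial p-prime}}

prime∤product : ∀ {q xs} → Prime q → All Prime xs → All (_≢ q) xs → ¬ q ∣ product xs
prime∤product q-prime []                   []             q∣1 = ℕ.<⇒≢ (prime⇒≥2 q-prime) (sym (∣1⇒≡1 q∣1))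
prime∤product q-prime (x-prime ∷ xs-prime) (x≢q ∷ xs≢q) q∣x*xs with euclidsLemma _ _ q-prime q∣x*xs
... | inj₂ q∣xs = prime∤product q-prime xs-prime xs≢q q∣xs
... | inj₁ q∣x  with prime⇒irreducible x-prime q∣x
...   | inj₁ q≡1 = ℕ.<⇒≢ (prime⇒≥2 q-prime) (sym q≡1)
...   | inj₂ q≡x = x≢q (sym q≡x)

2∣n⊎2∣1+n : ∀ n → 2 ∣ n ⊎ 2 ∣ suc n
2∣n⊎2∣1+n zero    = inj₁ (2 ∣0)
2∣n⊎2∣1+n (suc n) with 2∣n⊎2∣1+n n
... | inj₁ 2∣n   = inj₂ (∣m∣n⇒∣m+n ∣-refl 2∣n)
... | inj₂ 2∣1+n = inj₁ 2∣1+n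

odd<odd⇒2+≤ : ∀ {m n} → ¬ 2 ∣ m → ¬ 2 ∣ n → m < n → 2 + m ≤ n
odd<odd⇒2+≤ {m} 2∤m 2∤n m<n with ℕ.m≤n⇒m<n∨m≡n m<n
... | inj₁ 1+m<n = 1+m<n
... | inj₂ refl  = contradiction (2∣n⊎2∣1+n m) [ 2∤m , 2∤n ]′

-- Products over divisors in a commutative monoid

module Products {a} {A : Set a} (_∙_ : A → A → A) (ε : A) where

  ∏ : ℕ → (ℕ → A) → A
  ∏ zero    F = ε
  ∏ (suc k) F = F 1 ∙ ∏ k (F ∘ suc)

  select : ∀ {p} {P : Set p} → Dec P → A → A
  select (yes _) x = x
  select (no _)  _ = ε

  ∏∣ : ℕ → (ℕ → A) → A
  ∏∣ m F = ∏ m (λ d → select (d ∣? m) (F d))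

  ∏∣< : ℕ → (ℕ → A) → A
  ∏∣< m F = ∏ (m ∸ 1) (λ d → select (d ∣? m) (F d))

  onMultiplesOf : (q : ℕ) .{{_ : NonZero q}} → (ℕ → A) → ℕ → A
  onMultiplesOf q G d = select (q ∣? d) (G (d / q))

module ProductProperties {c ℓ} (M : CommutativeMonoid c ℓ) where

  open CommutativeMonoid M renaming (refl to ≈-refl; sym to ≈-sym; trans to ≈-trans)
  open Products _∙_ ε
  open import Algebra.Properties.CommutativeSemigroup commutativeSemigroup using (interchange)
  open import Algebra.Properties.Monoid monoid using (insertˡ; cancelˡ)
  open import Relation.Binary.Reasoning.Setoid setoid

  invertible-cancelˡ : ∀ {x x⁻¹ y z} → x ∙ x⁻¹ ≈ ε → x ∙ y ≈ x ∙ z → y ≈ z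
  invertible-cancelˡ {x} {x⁻¹} {y} {z} x∙x⁻¹≈ε x∙y≈x∙z = begin
    y               ≈⟨ insertˡ (≈-trans (comm x⁻¹ x) x∙x⁻¹≈ε) y ⟩
    x⁻¹ ∙ (x ∙ y)   ≈⟨ ∙-congˡ x∙y≈x∙z ⟩
    x⁻¹ ∙ (x ∙ z)   ≈⟨ cancelˡ (≈-trans (comm x⁻¹ x) x∙x⁻¹≈ε) z ⟩
    z               ∎

  inverse-unique : ∀ {x y z} → x ∙ y ≈ ε → x ∙ z ≈ ε → y ≈ z
  inverse-unique x∙y≈ε x∙z≈ε = invertible-cancelˡ x∙y≈ε (≈-trans x∙y≈ε (≈-sym x∙z≈ε))

  select-yes : ∀ {p} {P : Set p} (P? : Dec P) x → P → select P? x ≡ x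
  select-yes (yes _) x _  = refl
  select-yes (no ¬p) x p  = contradiction p ¬p

  select-no : ∀ {p} {P : Set p} (P? : Dec P) x → ¬ P → select P? x ≡ ε
  select-no (yes p) x ¬p = contradiction p ¬p
  select-no (no _)  x _  = refl

  select-cong : ∀ {p q} {P : Set p} {Q : Set q} (P? : Dec P) (Q? : Dec Q) {x y} →
                P ⇔ Q → x ≈ y → select P? x ≈ select Q? y
  select-cong (yes _) (yes _) _   x≈y = x≈y
  select-cong (yes p) (no ¬q) P⇔Q _   = contradiction (Equivalence.to P⇔Q p) ¬q
  select-cong (no ¬p) (yes q) P⇔Q _   = contradiction (Equivalence.from P⇔Q q) ¬p
  select-cong (no _)  (no _)  _   _   = ≈-refl

  select-∙ : ∀ {p} {P : Set p} (P? : Dec P) x y → select P? (x ∙ y) ≈ select P? x ∙ select P? y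
  select-∙ (yes _) x y = ≈-refl
  select-∙ (no _)  x y = ≈-sym (identityˡ ε)

  select-square : ∀ {p} {P : Set p} (P? : Dec P) {x} → x ∙ x ≈ ε → select P? x ∙ select P? x ≈ ε
  select-square (yes _) x∙x≈ε = x∙x≈ε
  select-square (no _)  _     = identityˡ ε

  foldr-filter : ∀ {p} {P : Pred ℕ p} (P? : Decidable P) F xs →
                 foldr _∙_ ε (map F (filter P? xs)) ≈ foldr _∙_ ε (map (λ x → select (P? x) (F x)) xs)
  foldr-filter P? F []       = ≈-refl
  foldr-filter P? F (x ∷ xs) with P? x
  ... | yes _ = ∙-congˡ (foldr-filter P? F xs)
  ... | no _  = ≈-trans (foldr-filter P? F xs) (≈-sym (identityˡ _))

  foldr-applyUpTo : ∀ k (F : ℕ → Carrier) g → foldr _∙_ ε (map F (applyUpTo (g ∘ suc) k)) ≡ ∏ k (F ∘ g)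
  foldr-applyUpTo zero    F g = refl
  foldr-applyUpTo (suc k) F g = cong (F (g 1) ∙_) (foldr-applyUpTo k F (g ∘ suc))

  ∏-cong : ∀ k {F G} → (∀ d → 1 ≤ d → d ≤ k → F d ≈ G d) → ∏ k F ≈ ∏ k G
  ∏-cong zero    _   = ≈-refl
  ∏-cong (suc k) F≈G =
    ∙-cong (F≈G 1 ℕ.≤-refl (s≤s z≤n)) (∏-cong k λ d 1≤d d≤k → F≈G (suc d) (s≤s z≤n) (s≤s d≤k))

  ∏-ε : ∀ k {F} → (∀ d → 1 ≤ d → d ≤ k → F d ≈ ε) → ∏ k F ≈ ε
  ∏-ε zero    _    = ≈-refl
  ∏-ε (suc k) F≈ε = ≈-trans (∙-cong (F≈ε 1 ℕ.≤-refl (s≤s z≤n)) (∏-ε k λ d 1≤d d≤k → F≈ε (suc d) (s≤s z≤n) (s≤s d≤k)))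
                          (identityˡ ε)

  ∏-∙ : ∀ k F G → ∏ k (λ d → F d ∙ G d) ≈ ∏ k F ∙ ∏ k G
  ∏-∙ zero    F G = ≈-sym (identityˡ ε)
  ∏-∙ (suc k) F G = ≈-trans (∙-congˡ (∏-∙ k (F ∘ suc) (G ∘ suc))) (interchange (F 1) (G 1) _ _)

  ∏-squares : ∀ k {F} → (∀ d → 1 ≤ d → d ≤ k → F d ∙ F d ≈ ε) → ∏ k F ∙ ∏ k F ≈ ε
  ∏-squares k {F} F²≈ε = ≈-trans (≈-sym (∏-∙ k F F)) (∏-ε k F²≈ε)

  ∏-+ : ∀ a b F → ∏ (a + b) F ≈ ∏ a F ∙ ∏ b (λ i → F (a + i))
  ∏-+ zero    b F = ≈-sym (identityˡ _)
  ∏-+ (suc a) b F = ≈-trans (∙-congˡ (∏-+ a b (F ∘ suc))) (≈-sym (assoc (F 1) _ _))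

  ∏-suc : ∀ k F → ∏ (suc k) F ≈ ∏ k F ∙ F (suc k)
  ∏-suc zero    F = comm (F 1) ε
  ∏-suc (suc k) F = ≈-trans (∙-congˡ (∏-suc k (F ∘ suc))) (≈-sym (assoc (F 1) _ _))

  ∏-first-last : ∀ k F → 1 ≤ k → (∀ d → 2 ≤ d → d ≤ k → F d ≈ ε) → ∏ (suc k) F ≈ F 1 ∙ F (suc k)
  ∏-first-last (suc k) F _ F≈ε = begin
    ∏ (2 + k) F                    ≈⟨ ∏-suc (suc k) F ⟩
    (F 1 ∙ ∏ k (F ∘ suc)) ∙ F (2 + k) ≈⟨ ∙-congʳ (∙-congˡ (∏-ε k λ d 1≤d d≤k → F≈ε (suc d) (s≤s 1≤d) (s≤s d≤k))) ⟩
    (F 1 ∙ ε) ∙ F (2 + k)          ≈⟨ ∙-congʳ (identityʳ (F 1)) ⟩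
    F 1 ∙ F (2 + k)                ∎

  ∏∣-∙ : ∀ m F G → ∏∣ m (λ d → F d ∙ G d) ≈ ∏∣ m F ∙ ∏∣ m G
  ∏∣-∙ m F G = ≈-trans (∏-cong m λ d _ _ → select-∙ (d ∣? m) (F d) (G d)) (∏-∙ m _ _)

  ∏∣-proper : ∀ {m} F → 1 ≤ m → ∏∣ m F ≈ ∏∣< m F ∙ F m
  ∏∣-proper {suc k} F _ = ≈-trans (∏-suc k _) (∙-congˡ (reflexive (select-yes (suc k ∣? suc k) _ ∣-refl)))

  ∏∣-prime : ∀ {p} F → Prime p → ∏∣ p F ≈ F 1 ∙ F p
  ∏∣-prime {p} F p-prime with prime⇒≥2 p-prime
  ... | s≤s (s≤s {n = k} _) = begin
    ∏∣ p F                                                ≈⟨ ∏-first-last (suc k) _ (s≤s z≤n) trivial ⟩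
    select (1 ∣? p) (F 1) ∙ select (p ∣? p) (F p)         ≈⟨ reflexive (cong₂ _∙_ (select-yes (1 ∣? p) _ (1∣ p)) (select-yes (p ∣? p) _ ∣-refl)) ⟩
    F 1 ∙ F p                                             ∎
    where
    trivial : ∀ d → 2 ≤ d → d ≤ suc k → select (d ∣? p) (F d) ≈ ε
    trivial d 2≤d d<p = reflexive (select-no (d ∣? p) (F d) λ d∣p → case prime⇒irreducible p-prime d∣p of λ
      { (inj₁ d≡1) → ℕ.<⇒≢ 2≤d (sym d≡1)
      ; (inj₂ d≡p) → ℕ.<⇒≢ (s≤s d<p) d≡p })

  ∏∣-extend : ∀ {m n} F → 1 ≤ m → m ≤ n → ∏ n (λ d → select (d ∣? m) (F d)) ≈ ∏∣ m F
  ∏∣-extend {m} {n} F 1≤m m≤n = begin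
    ∏ n G                                  ≡⟨ cong (λ k → ∏ k G) (ℕ.m+[n∸m]≡n m≤n) ⟨
    ∏ (m + (n ∸ m)) G                      ≈⟨ ∏-+ m (n ∸ m) G ⟩
    ∏∣ m F ∙ ∏ (n ∸ m) (λ i → G (m + i))   ≈⟨ ∙-congˡ (∏-ε (n ∸ m) λ i 1≤i _ → reflexive (select-no (m + i ∣? m) _ (too-big 1≤i))) ⟩
    ∏∣ m F ∙ ε                             ≈⟨ identityʳ _ ⟩
    ∏∣ m F                                 ∎
    where
    G : ℕ → Carrier
    G d = select (d ∣? m) (F d)
    too-big : ∀ {i} → 1 ≤ i → ¬ m + i ∣ m
    too-big 1≤i m+i∣m = ℕ.<⇒≱ (ℕ.m<m+n m 1≤i) (∣⇒≤ {{>-nonZero 1≤m}} m+i∣m)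

  ∏-onMultiplesOf : ∀ q .{{_ : NonZero q}} j G → ∏ (j * q) (onMultiplesOf q G) ≈ ∏ j G
  ∏-onMultiplesOf (suc q) zero    G = ≈-refl
  ∏-onMultiplesOf (suc q) (suc j) G = begin
    ∏ (suc q + j * suc q) H                                  ≈⟨ ∏-+ (suc q) (j * suc q) H ⟩
    ∏ (suc q) H ∙ ∏ (j * suc q) (λ i → H (suc q + i))        ≈⟨ ∙-cong first-block (∏-cong (j * suc q) λ i _ _ → shift i) ⟩
    G 1 ∙ ∏ (j * suc q) (onMultiplesOf (suc q) (G ∘ suc))    ≈⟨ ∙-congˡ (∏-onMultiplesOf (suc q) j (G ∘ suc)) ⟩
    ∏ (suc j) G                                              ∎
    where
    H : ℕ → Carrier
    H = onMultiplesOf (suc q) G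
    first-block : ∏ (suc q) H ≈ G 1
    first-block = begin
      ∏ (suc q) H    ≈⟨ ∏-suc q H ⟩
      ∏ q H ∙ H (suc q) ≈⟨ ∙-cong (∏-ε q λ d 1≤d d≤q → reflexive (select-no (suc q ∣? d) _ λ q∣d → ℕ.<⇒≱ (s≤s d≤q) (∣⇒≤ {{>-nonZero 1≤d}} q∣d)))
                                (reflexive (trans (select-yes (suc q ∣? suc q) _ ∣-refl) (cong G (n/n≡1 (suc q))))) ⟩
      ε ∙ G 1        ≈⟨ identityˡ (G 1) ⟩
      G 1            ∎
    shift : ∀ i → H (suc q + i) ≈ onMultiplesOf (suc q) (G ∘ suc) i
    shift i = select-cong (suc q ∣? suc q + i) (suc q ∣? i)
      (mk⇔ (λ q∣q+i → ∣m+n∣m⇒∣n q∣q+i ∣-refl) (∣m∣n⇒∣m+n ∣-refl))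
      (reflexive (cong G (trans (m/n≡1+[m∸n]/n (ℕ.m≤m+n (suc q) i)) (cong (λ k → suc (k / suc q)) (ℕ.m+n∸m≡n (suc q) i)))))

  ∏∣-*-prime : ∀ {q m} F → Prime q → ¬ q ∣ m → 1 ≤ m → ∏∣ (q * m) F ≈ ∏∣ m F ∙ ∏∣ m (λ d → F (q * d))
  ∏∣-*-prime {q} {m} F q-prime q∤m 1≤m = begin
    ∏∣ (q * m) F                                                   ≈⟨ ∏-cong (q * m) (λ d _ _ → split d) ⟩
    ∏ (q * m) (λ d → select (d ∣? m) (F d) ∙ H d)                  ≈⟨ ∏-∙ (q * m) _ H ⟩
    ∏ (q * m) (λ d → select (d ∣? m) (F d)) ∙ ∏ (q * m) H
      ≈⟨ ∙-cong (∏∣-extend F 1≤m (ℕ.m≤n*m m q)) (reflexive (cong (λ k → ∏ k H) (ℕ.*-comm q m))) ⟩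
    ∏∣ m F ∙ ∏ (m * q) H                                           ≈⟨ ∙-congˡ (∏-onMultiplesOf q m G) ⟩
    ∏∣ m F ∙ ∏∣ m (λ d → F (q * d))                                ∎
    where
    instance
      q≢0 : NonZero q
      q≢0 = prime⇒nonZero q-prime
    G : ℕ → Carrier
    G j = select (j ∣? m) (F (q * j))
    H : ℕ → Carrier
    H = onMultiplesOf q G
    split : ∀ d → select (d ∣? q * m) (F d) ≈ select (d ∣? m) (F d) ∙ H d
    split d with q ∣? d
    ... | yes q∣d = begin
      select (d ∣? q * m) (F d)       ≈⟨ select-cong (d ∣? q * m) (j ∣? m) d∣qm⇔j∣m (reflexive (cong F d≡qj)) ⟩
      G j                             ≈⟨ identityˡ (G j) ⟨
      ε ∙ G j                         ≡⟨ cong (_∙ G j) (select-no (d ∣? m) (F d) λ d∣m → q∤m (∣-trans q∣d d∣m)) ⟨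
      select (d ∣? m) (F d) ∙ G j     ∎
      where
      j = d / q
      d≡qj : d ≡ q * j
      d≡qj = sym (m*[n/m]≡n q∣d)
      d∣qm⇔j∣m : d ∣ q * m ⇔ j ∣ m
      d∣qm⇔j∣m = mk⇔ (λ d∣qm → *-cancelˡ-∣ q (subst (_∣ q * m) d≡qj d∣qm))
                      (λ j∣m → subst (_∣ q * m) (sym d≡qj) (*-monoʳ-∣ q j∣m))
    ... | no q∤d = begin
      select (d ∣? q * m) (F d)       ≈⟨ select-cong (d ∣? q * m) (d ∣? m) d∣qm⇔d∣m ≈-refl ⟩
      select (d ∣? m) (F d)           ≈⟨ identityʳ _ ⟨
      select (d ∣? m) (F d) ∙ ε       ∎
      where
      d∣qm⇔d∣m : d ∣ q * m ⇔ d ∣ m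
      d∣qm⇔d∣m = mk⇔ (coprime-divisor (prime∤⇒coprime q-prime q∤d)) (∣n⇒∣m*n q)

  module _ {N c F} (c∙c≈ε : c ∙ c ≈ ε) (∏∣F≈c : ∀ n → 1 ≤ n → N ≤ n → ∏∣ n F ≈ c)
           {q} (q-prime : Prime q) (N≤q : N ≤ q) where

    private
      1≤q : 1 ≤ q
      1≤q = ℕ.≤-trans (s≤s z≤n) (prime⇒≥2 q-prime)

    F1∙Fq≈c : F 1 ∙ F q ≈ c
    F1∙Fq≈c = ≈-trans (≈-sym (∏∣-prime F q-prime)) (∏∣F≈c q 1≤q N≤q)

    -- Comparing ∏∣ (q * m) F ≈ c with its factorisation ∏_{d ∣ m} (F d ∙ F (q * d)), every
    -- factor with 1 < d < m is ε by induction, so c ≈ c ∙ (F m ∙ F (q * m)).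
    Fm∙F[q*m]≈ε : ∀ m → 2 ≤ m → ¬ q ∣ m → F m ∙ F (q * m) ≈ ε
    Fm∙F[q*m]≈ε = <-rec _ step
      where
      step : ∀ m → (∀ {d} → d < m → 2 ≤ d → ¬ q ∣ d → F d ∙ F (q * d) ≈ ε) → 2 ≤ m → ¬ q ∣ m → F m ∙ F (q * m) ≈ ε
      step m@(suc k) IH (s≤s 1≤k) q∤m = begin
        X                          ≈⟨ insertˡ c∙c≈ε X ⟩
        c ∙ (c ∙ X)                ≈⟨ ∙-congˡ c∙X≈c ⟩
        c ∙ c                      ≈⟨ c∙c≈ε ⟩
        ε                          ∎
        where
        X = F m ∙ F (q * m)
        P : ℕ → Carrier
        P d = F d ∙ F (q * d)
        middle : ∀ d → 2 ≤ d → d ≤ k → select (d ∣? m) (P d) ≈ ε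
        middle d 2≤d d≤k with d ∣? m
        ... | yes d∣m = IH (s≤s d≤k) 2≤d λ q∣d → q∤m (∣-trans q∣d d∣m)
        ... | no _    = ≈-refl
        c∙X≈c : c ∙ X ≈ c
        c∙X≈c = begin
          c ∙ X                              ≈⟨ ∙-congʳ (≈-trans (∙-congˡ (reflexive (cong F (ℕ.*-identityʳ q)))) F1∙Fq≈c) ⟨
          P 1 ∙ X                            ≡⟨ cong₂ _∙_ (select-yes (1 ∣? m) (P 1) (1∣ m)) (select-yes (m ∣? m) X ∣-refl) ⟨
          select (1 ∣? m) (P 1) ∙ select (m ∣? m) X ≈⟨ ∏-first-last k _ 1≤k middle ⟨
          ∏∣ m P                             ≈⟨ ∏∣-∙ m F (λ d → F (q * d)) ⟩
          ∏∣ m F ∙ ∏∣ m (λ d → F (q * d))     ≈⟨ ∏∣-*-prime F q-prime q∤m (s≤s z≤n) ⟨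
          ∏∣ (q * m) F                       ≈⟨ ∏∣F≈c (q * m) (ℕ.≤-trans 1≤q (ℕ.m≤m*n q m)) (ℕ.≤-trans N≤q (ℕ.m≤m*n q m)) ⟩
          c                                  ∎

-- Polynomial arithmetic

1ₚ : Poly
1ₚ = + 1 ∷ []

-1ₚ : Poly
-1ₚ = - + 1 ∷ []

infix 4 _≐_

_≐_ : Poly → Poly → Set
p ≐ q = ∀ k → coeff p k ≡ coeff q k

coeff-drop1 : ∀ p k → coeff (drop 1 p) k ≡ coeff p (suc k)
coeff-drop1 []      k = refl
coeff-drop1 (a ∷ p) k = refl

coeff-⊕ : ∀ p q k → coeff (p ⊕ q) k ≡ coeff p k ℤ.+ coeff q k
coeff-⊕ []      q       k       = sym (ℤ.+-identityˡ _)
coeff-⊕ (a ∷ p) []      k       = sym (ℤ.+-identityʳ _)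
coeff-⊕ (a ∷ p) (b ∷ q) zero    = refl
coeff-⊕ (a ∷ p) (b ∷ q) (suc k) = coeff-⊕ p q k

coeff-scale : ∀ a q k → coeff (map (a ℤ.*_) q) k ≡ a ℤ.* coeff q k
coeff-scale a []      k       = sym (ℤ.*-zeroʳ a)
coeff-scale a (b ∷ q) zero    = refl
coeff-scale a (b ∷ q) (suc k) = coeff-scale a q k

coeff-⊗-zero : ∀ p q → coeff (p ⊗ q) 0 ≡ coeff p 0 ℤ.* coeff q 0
coeff-⊗-zero []      q = refl
coeff-⊗-zero (a ∷ p) q = begin
  coeff (map (a ℤ.*_) q ⊕ (+ 0 ∷ p ⊗ q)) 0 ≡⟨ coeff-⊕ (map (a ℤ.*_) q) _ 0 ⟩
  coeff (map (a ℤ.*_) q) 0 ℤ.+ + 0         ≡⟨ ℤ.+-identityʳ _ ⟩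
  coeff (map (a ℤ.*_) q) 0                 ≡⟨ coeff-scale a q 0 ⟩
  a ℤ.* coeff q 0                          ∎
  where open ≡-Reasoning

coeff-⊗-suc : ∀ p q k →
  coeff (p ⊗ q) (suc k) ≡ coeff p 0 ℤ.* coeff q (suc k) ℤ.+ coeff (drop 1 p ⊗ q) k
coeff-⊗-suc []      q k = refl
coeff-⊗-suc (a ∷ p) q k = begin
  coeff (map (a ℤ.*_) q ⊕ (+ 0 ∷ p ⊗ q)) (suc k)      ≡⟨ coeff-⊕ (map (a ℤ.*_) q) _ (suc k) ⟩
  coeff (map (a ℤ.*_) q) (suc k) ℤ.+ coeff (p ⊗ q) k  ≡⟨ cong (ℤ._+ coeff (p ⊗ q) k) (coeff-scale a q (suc k)) ⟩
  a ℤ.* coeff q (suc k) ℤ.+ coeff (p ⊗ q) k           ∎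
  where open ≡-Reasoning

coeff-1ₚ-⊗ : ∀ q → 1ₚ ⊗ q ≐ q
coeff-1ₚ-⊗ q zero    = trans (coeff-⊗-zero 1ₚ q) (ℤ.*-identityˡ _)
coeff-1ₚ-⊗ q (suc k) = trans (coeff-⊗-suc 1ₚ q k) (trans (ℤ.+-identityʳ _) (ℤ.*-identityˡ _))

coeff-⊗-sucʳ : ∀ p q k →
  coeff (p ⊗ q) (suc k) ≡ coeff q 0 ℤ.* coeff p (suc k) ℤ.+ coeff (p ⊗ drop 1 q) k
coeff-⊗-sucʳ p q zero = begin
  coeff (p ⊗ q) 1                          ≡⟨ coeff-⊗-suc p q 0 ⟩
  p₀ ℤ.* coeff q 1 ℤ.+ coeff (p′ ⊗ q) 0    ≡⟨ cong₂ (λ x y → p₀ ℤ.* x ℤ.+ y) (sym (coeff-drop1 q 0)) (coeff-⊗-zero p′ q) ⟩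
  p₀ ℤ.* q′₀ ℤ.+ coeff p′ 0 ℤ.* q₀         ≡⟨ cong (λ x → p₀ ℤ.* q′₀ ℤ.+ x ℤ.* q₀) (coeff-drop1 p 0) ⟩
  p₀ ℤ.* q′₀ ℤ.+ coeff p 1 ℤ.* q₀          ≡⟨ trans (ℤ.+-comm (p₀ ℤ.* q′₀) _) (cong (ℤ._+ p₀ ℤ.* q′₀) (ℤ.*-comm (coeff p 1) q₀)) ⟩
  q₀ ℤ.* coeff p 1 ℤ.+ p₀ ℤ.* q′₀          ≡⟨ cong (ℤ._+_ (q₀ ℤ.* coeff p 1)) (sym (coeff-⊗-zero p (drop 1 q))) ⟩
  q₀ ℤ.* coeff p 1 ℤ.+ coeff (p ⊗ drop 1 q) 0 ∎
  where
  open ≡-Reasoning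
  p₀ = coeff p 0
  q₀ = coeff q 0
  q′₀ = coeff (drop 1 q) 0
  p′ = drop 1 p
coeff-⊗-sucʳ p q (suc k) = begin
  coeff (p ⊗ q) (2 + k)                                    ≡⟨ coeff-⊗-suc p q (suc k) ⟩
  p₀ ℤ.* coeff q (2 + k) ℤ.+ coeff (p′ ⊗ q) (suc k)        ≡⟨ cong (ℤ._+_ (p₀ ℤ.* coeff q (2 + k))) (coeff-⊗-sucʳ p′ q k) ⟩
  p₀ ℤ.* coeff q (2 + k) ℤ.+ (q₀ ℤ.* coeff p′ (suc k) ℤ.+ r)
    ≡⟨ cong₂ (λ x y → p₀ ℤ.* x ℤ.+ (q₀ ℤ.* y ℤ.+ r)) (sym (coeff-drop1 q (suc k))) (coeff-drop1 p (suc k)) ⟩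
  p₀ ℤ.* coeff q′ (suc k) ℤ.+ (q₀ ℤ.* coeff p (2 + k) ℤ.+ r)
    ≡⟨ ℤ+.x∙yz≈y∙xz (p₀ ℤ.* coeff q′ (suc k)) (q₀ ℤ.* coeff p (2 + k)) r ⟩
  q₀ ℤ.* coeff p (2 + k) ℤ.+ (p₀ ℤ.* coeff q′ (suc k) ℤ.+ r)
    ≡⟨ cong (ℤ._+_ (q₀ ℤ.* coeff p (2 + k))) (sym (coeff-⊗-suc p q′ k)) ⟩
  q₀ ℤ.* coeff p (2 + k) ℤ.+ coeff (p ⊗ q′) (suc k)        ∎
  where
  open ≡-Reasoning
  p₀ = coeff p 0
  q₀ = coeff q 0
  p′ = drop 1 p
  q′ = drop 1 q
  r = coeff (p′ ⊗ q′) k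

coeff-⊗-comm : ∀ p q → p ⊗ q ≐ q ⊗ p
coeff-⊗-comm p q zero    = trans (coeff-⊗-zero p q) (trans (ℤ.*-comm (coeff p 0) (coeff q 0)) (sym (coeff-⊗-zero q p)))
coeff-⊗-comm p q (suc k) = begin
  coeff (p ⊗ q) (suc k)                                       ≡⟨ coeff-⊗-suc p q k ⟩
  coeff p 0 ℤ.* coeff q (suc k) ℤ.+ coeff (drop 1 p ⊗ q) k    ≡⟨ cong (ℤ._+_ (coeff p 0 ℤ.* coeff q (suc k))) (coeff-⊗-comm (drop 1 p) q k) ⟩
  coeff p 0 ℤ.* coeff q (suc k) ℤ.+ coeff (q ⊗ drop 1 p) k    ≡⟨ coeff-⊗-sucʳ q p k ⟨
  coeff (q ⊗ p) (suc k)                                       ∎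
  where open ≡-Reasoning

coeff-∷-⊗ : ∀ a p q k → coeff ((a ∷ p) ⊗ q) k ≡ a ℤ.* coeff q k ℤ.+ coeff (+ 0 ∷ p ⊗ q) k
coeff-∷-⊗ a p q k = trans (coeff-⊕ (map (a ℤ.*_) q) _ k) (cong (ℤ._+ coeff (+ 0 ∷ p ⊗ q) k) (coeff-scale a q k))

coeff-⊗-congˡ : ∀ p p′ q k → (∀ i → i ≤ k → coeff p i ≡ coeff p′ i) →
                coeff (p ⊗ q) k ≡ coeff (p′ ⊗ q) k
coeff-⊗-congˡ p p′ q zero    eq = begin
  coeff (p ⊗ q) 0          ≡⟨ coeff-⊗-zero p q ⟩
  coeff p 0 ℤ.* coeff q 0  ≡⟨ cong (ℤ._* coeff q 0) (eq 0 z≤n) ⟩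
  coeff p′ 0 ℤ.* coeff q 0 ≡⟨ coeff-⊗-zero p′ q ⟨
  coeff (p′ ⊗ q) 0         ∎
  where open ≡-Reasoning
coeff-⊗-congˡ p p′ q (suc k) eq = begin
  coeff (p ⊗ q) (suc k)                                          ≡⟨ coeff-⊗-suc p q k ⟩
  coeff p 0 ℤ.* coeff q (suc k) ℤ.+ coeff (drop 1 p ⊗ q) k
    ≡⟨ cong₂ (λ x y → x ℤ.* coeff q (suc k) ℤ.+ y) (eq 0 z≤n) (coeff-⊗-congˡ (drop 1 p) (drop 1 p′) q k eq′) ⟩
  coeff p′ 0 ℤ.* coeff q (suc k) ℤ.+ coeff (drop 1 p′ ⊗ q) k     ≡⟨ coeff-⊗-suc p′ q k ⟨
  coeff (p′ ⊗ q) (suc k)                                         ∎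
  where
  open ≡-Reasoning
  eq′ : ∀ i → i ≤ k → coeff (drop 1 p) i ≡ coeff (drop 1 p′) i
  eq′ i i≤k = trans (coeff-drop1 p i) (trans (eq (suc i) (s≤s i≤k)) (sym (coeff-drop1 p′ i)))

coeff-⊗-congʳ : ∀ p {q q′} k → (∀ i → i ≤ k → coeff q i ≡ coeff q′ i) →
                coeff (p ⊗ q) k ≡ coeff (p ⊗ q′) k
coeff-⊗-congʳ p {q} {q′} k eq =
  trans (coeff-⊗-comm p q k) (trans (coeff-⊗-congˡ q q′ p k eq) (coeff-⊗-comm q′ p k))

coeff-⊕-⊗ : ∀ p q r k → coeff ((p ⊕ q) ⊗ r) k ≡ coeff (p ⊗ r) k ℤ.+ coeff (q ⊗ r) k
coeff-⊕-⊗ []      q       r k = sym (ℤ.+-identityˡ _)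
coeff-⊕-⊗ (a ∷ p) []      r k = sym (ℤ.+-identityʳ _)
coeff-⊕-⊗ (a ∷ p) (b ∷ q) r k = begin
  coeff (((a ∷ p) ⊕ (b ∷ q)) ⊗ r) k                         ≡⟨ coeff-∷-⊗ (a ℤ.+ b) (p ⊕ q) r k ⟩
  (a ℤ.+ b) ℤ.* coeff r k ℤ.+ coeff (+ 0 ∷ (p ⊕ q) ⊗ r) k   ≡⟨ cong₂ ℤ._+_ (ℤ.*-distribʳ-+ (coeff r k) a b) (tail-sum k) ⟩
  (a ℤ.* coeff r k ℤ.+ b ℤ.* coeff r k) ℤ.+ (coeff (+ 0 ∷ p ⊗ r) k ℤ.+ coeff (+ 0 ∷ q ⊗ r) k)
    ≡⟨ ℤ+.interchange (a ℤ.* coeff r k) (b ℤ.* coeff r k) (coeff (+ 0 ∷ p ⊗ r) k) (coeff (+ 0 ∷ q ⊗ r) k) ⟩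
  (a ℤ.* coeff r k ℤ.+ coeff (+ 0 ∷ p ⊗ r) k) ℤ.+ (b ℤ.* coeff r k ℤ.+ coeff (+ 0 ∷ q ⊗ r) k)
    ≡⟨ cong₂ ℤ._+_ (coeff-∷-⊗ a p r k) (coeff-∷-⊗ b q r k) ⟨
  coeff ((a ∷ p) ⊗ r) k ℤ.+ coeff ((b ∷ q) ⊗ r) k            ∎
  where
  open ≡-Reasoning
  tail-sum : ∀ k → coeff (+ 0 ∷ (p ⊕ q) ⊗ r) k ≡ coeff (+ 0 ∷ p ⊗ r) k ℤ.+ coeff (+ 0 ∷ q ⊗ r) k
  tail-sum zero    = refl
  tail-sum (suc k) = coeff-⊕-⊗ p q r k

coeff-scale-⊗ : ∀ a p r k → coeff (map (a ℤ.*_) p ⊗ r) k ≡ a ℤ.* coeff (p ⊗ r) k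
coeff-scale-⊗ a []      r k = sym (ℤ.*-zeroʳ a)
coeff-scale-⊗ a (b ∷ p) r k = begin
  coeff ((a ℤ.* b ∷ map (a ℤ.*_) p) ⊗ r) k                              ≡⟨ coeff-∷-⊗ (a ℤ.* b) (map (a ℤ.*_) p) r k ⟩
  a ℤ.* b ℤ.* coeff r k ℤ.+ coeff (+ 0 ∷ map (a ℤ.*_) p ⊗ r) k          ≡⟨ cong₂ ℤ._+_ (ℤ.*-assoc a b (coeff r k)) (tail-scale k) ⟩
  a ℤ.* (b ℤ.* coeff r k) ℤ.+ a ℤ.* coeff (+ 0 ∷ p ⊗ r) k               ≡⟨ ℤ.*-distribˡ-+ a _ _ ⟨
  a ℤ.* (b ℤ.* coeff r k ℤ.+ coeff (+ 0 ∷ p ⊗ r) k)                     ≡⟨ cong (a ℤ.*_) (coeff-∷-⊗ b p r k) ⟨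
  a ℤ.* coeff ((b ∷ p) ⊗ r) k                                          ∎
  where
  open ≡-Reasoning
  tail-scale : ∀ k → coeff (+ 0 ∷ map (a ℤ.*_) p ⊗ r) k ≡ a ℤ.* coeff (+ 0 ∷ p ⊗ r) k
  tail-scale zero    = sym (ℤ.*-zeroʳ a)
  tail-scale (suc k) = coeff-scale-⊗ a p r k

coeff-⊗-assoc : ∀ p q r → (p ⊗ q) ⊗ r ≐ p ⊗ (q ⊗ r)
coeff-⊗-assoc []      q r k = refl
coeff-⊗-assoc (a ∷ p) q r k = begin
  coeff ((map (a ℤ.*_) q ⊕ (+ 0 ∷ p ⊗ q)) ⊗ r) k                     ≡⟨ coeff-⊕-⊗ (map (a ℤ.*_) q) _ r k ⟩
  coeff (map (a ℤ.*_) q ⊗ r) k ℤ.+ coeff ((+ 0 ∷ p ⊗ q) ⊗ r) k       ≡⟨ cong₂ ℤ._+_ (coeff-scale-⊗ a q r k) (tail-assoc k) ⟩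
  a ℤ.* coeff (q ⊗ r) k ℤ.+ coeff (+ 0 ∷ p ⊗ (q ⊗ r)) k              ≡⟨ coeff-∷-⊗ a p (q ⊗ r) k ⟨
  coeff ((a ∷ p) ⊗ (q ⊗ r)) k                                       ∎
  where
  open ≡-Reasoning
  tail-assoc : ∀ k → coeff ((+ 0 ∷ p ⊗ q) ⊗ r) k ≡ coeff (+ 0 ∷ p ⊗ (q ⊗ r)) k
  tail-assoc k = begin
    coeff ((+ 0 ∷ p ⊗ q) ⊗ r) k                                ≡⟨ coeff-∷-⊗ (+ 0) (p ⊗ q) r k ⟩
    + 0 ℤ.* coeff r k ℤ.+ coeff (+ 0 ∷ (p ⊗ q) ⊗ r) k          ≡⟨ ℤ.+-identityˡ _ ⟩
    coeff (+ 0 ∷ (p ⊗ q) ⊗ r) k                                ≡⟨ shifted k ⟩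
    coeff (+ 0 ∷ p ⊗ (q ⊗ r)) k                                ∎
    where
    shifted : ∀ k → coeff (+ 0 ∷ (p ⊗ q) ⊗ r) k ≡ coeff (+ 0 ∷ p ⊗ (q ⊗ r)) k
    shifted zero    = refl
    shifted (suc k) = coeff-⊗-assoc p q r k

coeff-monomial-< : ∀ {a k} → k < a → coeff (monomial a) k ≡ + 0
coeff-monomial-< {suc a} {zero}  _         = refl
coeff-monomial-< {suc a} {suc k} (s≤s k<a) = coeff-monomial-< k<a

coeff-0∷-⊗ : ∀ p g k → coeff ((+ 0 ∷ p) ⊗ g) k ≡ coeff (+ 0 ∷ p ⊗ g) k
coeff-0∷-⊗ p g k = trans (coeff-∷-⊗ (+ 0) p g k) (ℤ.+-identityˡ _)

coeff-monomial-⊗-< : ∀ a g {k} → k < a → coeff (monomial a ⊗ g) k ≡ + 0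
coeff-monomial-⊗-< (suc a) g {zero}  _         = coeff-0∷-⊗ (monomial a) g 0
coeff-monomial-⊗-< (suc a) g {suc k} (s≤s k<a) = trans (coeff-0∷-⊗ (monomial a) g (suc k)) (coeff-monomial-⊗-< a g k<a)

coeff-monomial-⊗-+ : ∀ a g j → coeff (monomial a ⊗ g) (a + j) ≡ coeff g j
coeff-monomial-⊗-+ zero    g j = coeff-1ₚ-⊗ g j
coeff-monomial-⊗-+ (suc a) g j = trans (coeff-0∷-⊗ (monomial a) g (suc (a + j))) (coeff-monomial-⊗-+ a g j)

coeff-[-1ₚ]⊗ : ∀ g k → coeff (-1ₚ ⊗ g) k ≡ - coeff g k
coeff-[-1ₚ]⊗ g k = begin
  coeff (-1ₚ ⊗ g) k                           ≡⟨ coeff-∷-⊗ (- + 1) [] g k ⟩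
  - + 1 ℤ.* coeff g k ℤ.+ coeff (+ 0 ∷ []) k  ≡⟨ cong₂ ℤ._+_ (ℤ.-1*i≡-i (coeff g k)) (zero-tail k) ⟩
  - coeff g k ℤ.+ + 0                         ≡⟨ ℤ.+-identityʳ _ ⟩
  - coeff g k                                 ∎
  where
  open ≡-Reasoning
  zero-tail : ∀ k → coeff (+ 0 ∷ []) k ≡ + 0
  zero-tail zero    = refl
  zero-tail (suc k) = refl

coeff-xPowMinusOne-⊗ : ∀ a g k → coeff (xPowMinusOne a ⊗ g) k ≡ coeff (monomial a ⊗ g) k ℤ.- coeff g k
coeff-xPowMinusOne-⊗ a g k =
  trans (coeff-⊕-⊗ (monomial a) -1ₚ g k) (cong (ℤ._+_ (coeff (monomial a ⊗ g) k)) (coeff-[-1ₚ]⊗ g k))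

-- Equality modulo X^N

-- A record rather than the bare function type, so that p and q can be inferred from a proof
-- (coeff is not injective).
infix 4 _≈[_]_

record _≈[_]_ (p : Poly) (N : ℕ) (q : Poly) : Set where
  constructor mk≈
  field coeffs : toSeries p ≡ toSeries q mod-X^ N

open _≈[_]_ public

module _ {N : ℕ} where

  ≐⇒≈ : ∀ {p q} → p ≐ q → p ≈[ N ] q
  ≐⇒≈ eq = mk≈ λ k _ → eq k

  ≈-refl : ∀ {p} → p ≈[ N ] p
  ≈-refl = mk≈ λ _ _ → refl

  ≈-sym : ∀ {p q} → p ≈[ N ] q → q ≈[ N ] p
  ≈-sym p≈q = mk≈ λ k k<N → sym (coeffs p≈q k k<N)

  ≈-trans : ∀ {p q r} → p ≈[ N ] q → q ≈[ N ] r → p ≈[ N ] r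
  ≈-trans p≈q q≈r = mk≈ λ k k<N → trans (coeffs p≈q k k<N) (coeffs q≈r k k<N)

  ⊗-cong : ∀ {p p′ q q′} → p ≈[ N ] p′ → q ≈[ N ] q′ → p ⊗ q ≈[ N ] p′ ⊗ q′
  ⊗-cong {p} {p′} {q} {q′} p≈p′ q≈q′ = mk≈ λ k k<N →
    trans (coeff-⊗-congˡ p p′ q k (below p≈p′ k<N)) (coeff-⊗-congʳ p′ k (below q≈q′ k<N))
    where
    below : ∀ {r s k} → r ≈[ N ] s → k < N → ∀ i → i ≤ k → coeff r i ≡ coeff s i
    below r≈s k<N i i≤k = coeffs r≈s i (ℕ.≤-<-trans i≤k k<N)

  ⊗-congˡ : ∀ p {q q′} → q ≈[ N ] q′ → p ⊗ q ≈[ N ] p ⊗ q′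
  ⊗-congˡ p = ⊗-cong (≈-refl {p})

  ⊗-congʳ : ∀ q {p p′} → p ≈[ N ] p′ → p ⊗ q ≈[ N ] p′ ⊗ q
  ⊗-congʳ q p≈p′ = ⊗-cong p≈p′ (≈-refl {q})

≈-toSeries : ∀ {N p q f} → p ≈[ N ] q → toSeries q ≡ f mod-X^ N → toSeries p ≡ f mod-X^ N
≈-toSeries p≈q q≡f k k<N = trans (coeffs p≈q k k<N) (q≡f k k<N)

≈-weaken : ∀ {M N p q} → M ≤ N → p ≈[ N ] q → p ≈[ M ] q
≈-weaken M≤N p≈q = mk≈ λ k k<M → coeffs p≈q k (ℕ.<-≤-trans k<M M≤N)

⊗-commutativeMonoid : ℕ → CommutativeMonoid 0ℓ 0ℓ
⊗-commutativeMonoid N = record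
  { Carrier = Poly
  ; _≈_ = _≈[ N ]_
  ; _∙_ = _⊗_
  ; ε = 1ₚ
  ; isCommutativeMonoid = isCommutativeMonoidˡ record
    { isSemigroup = record
      { isMagma = record
        { isEquivalence = record { refl = ≈-refl ; sym = ≈-sym ; trans = ≈-trans }
        ; ∙-cong = ⊗-cong }
      ; assoc = λ p q r → ≐⇒≈ (coeff-⊗-assoc p q r) }
    ; identityˡ = λ p → ≐⇒≈ (coeff-1ₚ-⊗ p)
    ; comm = λ p q → ≐⇒≈ (coeff-⊗-comm p q) } }


module Mod-X^ (N : ℕ) where
  open CommutativeMonoid (⊗-commutativeMonoid N) public
    using (setoid; reflexive; assoc; comm; identityˡ; identityʳ; ∙-cong; ∙-congˡ; ∙-congʳ; commutativeSemigroup)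
  open ProductProperties (⊗-commutativeMonoid N) public
  open import Algebra.Properties.CommutativeSemigroup commutativeSemigroup public using (interchange; x∙yz≈y∙xz)
  open import Relation.Binary.Reasoning.Setoid setoid public

open Products _⊗_ 1ₚ

-1ₚ²≈1ₚ : ∀ {N} → -1ₚ ⊗ -1ₚ ≈[ N ] 1ₚ
-1ₚ²≈1ₚ = mk≈ λ { zero _ → refl ; (suc k) _ → refl }

take-≈ : ∀ n p → take n p ≈[ n ] p
take-≈ n p = mk≈ (coeff-take n p)
  where
  coeff-take : ∀ n p k → k < n → coeff (take n p) k ≡ coeff p k
  coeff-take (suc n) []      k       _         = refl
  coeff-take (suc n) (a ∷ p) zero    _         = refl
  coeff-take (suc n) (a ∷ p) (suc k) (s≤s k<n) = coeff-take n p k k<n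

coeff-≥length : ∀ p {k} → length p ≤ k → coeff p k ≡ + 0
coeff-≥length []      _         = refl
coeff-≥length (a ∷ p) (s≤s len≤k) = coeff-≥length p len≤k

≈-extend : ∀ {M N p q} → length p ≤ M → length q ≤ M → p ≈[ M ] q → p ≈[ N ] q
≈-extend {M} {N} {p} {q} p≤M q≤M p≈q = mk≈ λ k _ → case k ℕ.<? M of λ
  { (yes k<M) → coeffs p≈q k k<M
  ; (no k≮M)  → trans (coeff-≥length p (ℕ.≤-trans p≤M (ℕ.≮⇒≥ k≮M))) (sym (coeff-≥length q (ℕ.≤-trans q≤M (ℕ.≮⇒≥ k≮M)))) }

-- Power-series inverses

Σ< : ℕ → (ℕ → ℤ) → ℤ
Σ< n f = foldr ℤ._+_ (+ 0) (applyUpTo f n)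

Σ<-cong : ∀ n {f g} → (∀ i → i < n → f i ≡ g i) → Σ< n f ≡ Σ< n g
Σ<-cong zero    _   = refl
Σ<-cong (suc n) f≡g = cong₂ ℤ._+_ (f≡g 0 (s≤s z≤n)) (Σ<-cong n λ i i<n → f≡g (suc i) (s≤s i<n))

coeff-⊗ : ∀ p q k → coeff (p ⊗ q) k ≡ Σ< (suc k) (λ i → coeff p i ℤ.* coeff q (k ∸ i))
coeff-⊗ p q zero    = trans (coeff-⊗-zero p q) (sym (ℤ.+-identityʳ _))
coeff-⊗ p q (suc k) = trans (coeff-⊗-suc p q k) (cong (ℤ._+_ (coeff p 0 ℤ.* coeff q (suc k)))
  (trans (coeff-⊗ (drop 1 p) q k) (Σ<-cong (suc k) λ i _ → cong (ℤ._* coeff q (k ∸ i)) (coeff-drop1 p i))))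

convTail≡Σ< : ∀ g h k → convTail g h k ≡ Σ< k (λ j → coeff g (suc j) ℤ.* coeff h (k ∸ suc j))
convTail≡Σ< g h k = cong (foldr ℤ._+_ (+ 0)) (map-applyUpTo id _ k)

coeff-⊗-convTail : ∀ g h k → coeff (g ⊗ h) (suc k) ≡ coeff g 0 ℤ.* coeff h (suc k) ℤ.+ convTail g h (suc k)
coeff-⊗-convTail g h k =
  trans (coeff-⊗ g h (suc k)) (cong (ℤ._+_ (coeff g 0 ℤ.* coeff h (suc k))) (sym (convTail≡Σ< g h (suc k))))

convTail-cong : ∀ g {h h′} k → (∀ i → i < k → coeff h i ≡ coeff h′ i) → convTail g h k ≡ convTail g h′ k
convTail-cong g {h} {h′} k h≡h′ = begin
  convTail g h k                                             ≡⟨ convTail≡Σ< g h k ⟩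
  Σ< k (λ j → coeff g (suc j) ℤ.* coeff h (k ∸ suc j))        ≡⟨ Σ<-cong k (λ j j<k → cong (coeff g (suc j) ℤ.*_) (h≡h′ _ (∸-suc< j<k))) ⟩
  Σ< k (λ j → coeff g (suc j) ℤ.* coeff h′ (k ∸ suc j))       ≡⟨ convTail≡Σ< g h′ k ⟨
  convTail g h′ k                                            ∎
  where
  open ≡-Reasoning
  ∸-suc< : ∀ {j k} → j < k → k ∸ suc j < k
  ∸-suc< {j} {suc k} _ = s≤s (ℕ.m∸n≤m k j)

length-invSeries : ∀ g N → length (invSeries g N) ≡ N
length-invSeries g zero    = refl
length-invSeries g (suc N) = trans (length-++ (invSeries g N)) (trans (ℕ.+-comm _ 1) (cong suc (length-invSeries g N)))

coeff-invSeries-stable : ∀ g {N k} → k < N → coeff (invSeries g N) k ≡ coeff (invSeries g (suc k)) k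
coeff-invSeries-stable g {suc N} {k} (s≤s k≤N) with ℕ.m≤n⇒m<n∨m≡n k≤N
... | inj₂ refl = refl
... | inj₁ k<N  = trans (coeff-++ˡ (invSeries g N) (subst (k <_) (sym (length-invSeries g N)) k<N))
                        (coeff-invSeries-stable g k<N)
  where
  coeff-++ˡ : ∀ xs {ys k} → k < length xs → coeff (xs ++ ys) k ≡ coeff xs k
  coeff-++ˡ (x ∷ xs) {k = zero}  _         = refl
  coeff-++ˡ (x ∷ xs) {k = suc k} (s≤s k<n) = coeff-++ˡ xs k<n

coeff-invSeries-suc : ∀ g k →
  coeff (invSeries g (2 + k)) (suc k) ≡ - (coeff g 0 ℤ.* convTail g (invSeries g (suc k)) (suc k))
coeff-invSeries-suc g k = subst (λ i → coeff (hs ++ (next ∷ [])) i ≡ next) (length-invSeries g (suc k)) (coeff-∷ʳ hs)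
  where
  hs = invSeries g (suc k)
  next = - (coeff g 0 ℤ.* convTail g hs (suc k))
  coeff-∷ʳ : ∀ xs {y} → coeff (xs ++ (y ∷ [])) (length xs) ≡ y
  coeff-∷ʳ []       = refl
  coeff-∷ʳ (x ∷ xs) = coeff-∷ʳ xs

-- invSeries uses g₀ as its own inverse, hence the hypothesis g₀² = 1, stated modulo X.
invSeries-inverse : ∀ g N → g ⊗ g ≈[ 1 ] 1ₚ → g ⊗ invSeries g N ≈[ N ] 1ₚ
invSeries-inverse g N g²≈1 = mk≈ coeff-≡
  where
  open ≡-Reasoning
  g₀ = coeff g 0
  h = invSeries g N
  g₀²≡1 : g₀ ℤ.* g₀ ≡ + 1
  g₀²≡1 = trans (sym (coeff-⊗-zero g g)) (coeffs g²≈1 0 (s≤s z≤n))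
  coeff-≡ : ∀ k → k < N → coeff (g ⊗ h) k ≡ coeff 1ₚ k
  coeff-≡ zero    0<N = trans (coeff-⊗-zero g h) (trans (cong (g₀ ℤ.*_) (coeff-invSeries-stable g 0<N)) g₀²≡1)
  coeff-≡ (suc k) k<N = begin
    coeff (g ⊗ h) (suc k)                       ≡⟨ coeff-⊗-convTail g h k ⟩
    g₀ ℤ.* coeff h (suc k) ℤ.+ convTail g h (suc k)
      ≡⟨ cong₂ (λ x y → g₀ ℤ.* x ℤ.+ y) (trans (coeff-invSeries-stable g k<N) (coeff-invSeries-suc g k))
               (convTail-cong g {h} {invSeries g (suc k)} (suc k) λ i i<k → trans (coeff-invSeries-stable g (ℕ.<-trans i<k k<N))
                                                         (sym (coeff-invSeries-stable g i<k))) ⟩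
    g₀ ℤ.* - (g₀ ℤ.* c) ℤ.+ c                   ≡⟨ cong (ℤ._+ c) (ℤ.neg-distribʳ-* g₀ (g₀ ℤ.* c)) ⟨
    - (g₀ ℤ.* (g₀ ℤ.* c)) ℤ.+ c                 ≡⟨ cong (λ x → - x ℤ.+ c) (trans (sym (ℤ.*-assoc g₀ g₀ c)) (cong (ℤ._* c) g₀²≡1)) ⟩
    - (+ 1 ℤ.* c) ℤ.+ c                         ≡⟨ cong (λ x → - x ℤ.+ c) (ℤ.*-identityˡ c) ⟩
    - c ℤ.+ c                                   ≡⟨ ℤ.+-inverseˡ c ⟩
    + 0                                         ∎
    where
    c = convTail g (invSeries g (suc k)) (suc k)

invSeries-≈[1] : ∀ g M → 1 ≤ M → invSeries g M ≈[ 1 ] g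
invSeries-≈[1] g M 1≤M = mk≈ λ { zero _ → coeff-invSeries-stable g 1≤M ; (suc k) (s≤s ()) }

-- Cyclotomic polynomials

Φ : ℕ → Poly
Φ = cyclotomic

ones : ℕ → Poly
ones p = replicate p (+ 1)

cyclotomicUpTo-stable : ∀ {k d} → 1 ≤ d → d ≤ k → cyclotomicUpTo k d ≡ Φ d
cyclotomicUpTo-stable {zero}  (s≤s _) ()
cyclotomicUpTo-stable {suc k} {d} 1≤d d≤k with ℕ.m≤n⇒m<n∨m≡n d≤k
... | inj₂ refl = refl
... | inj₁ (s≤s d≤k′) rewrite dec-false (d ≟ suc k) (ℕ.<⇒≢ (s≤s d≤k′)) = cyclotomicUpTo-stable 1≤d d≤k′

cyclotomic-suc : ∀ m → Φ (suc m) ≡ newCyclotomic (suc m) (cyclotomicUpTo m)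
cyclotomic-suc m rewrite dec-true (m ≟ m) refl = refl

length-Φ : ∀ m → length (Φ (suc m)) ≤ 2 + m
length-Φ m = subst (λ p → length p ≤ 2 + m) (sym (cyclotomic-suc m))
  (length-take≤ (2 + m) (xPowMinusOne (suc m) ⊗ invSeries (properDivisorProduct (suc m) (cyclotomicUpTo m)) (2 + m)))
  where
  length-take≤ : ∀ n (xs : Poly) → length (take n xs) ≤ n
  length-take≤ zero    xs       = z≤n
  length-take≤ (suc n) []       = z≤n
  length-take≤ (suc n) (x ∷ xs) = s≤s (length-take≤ n xs)

properDivisorProduct-≈ : ∀ {N} m → properDivisorProduct m (cyclotomicUpTo (m ∸ 1)) ≈[ N ] ∏∣< m Φ
properDivisorProduct-≈ {N} m = begin
  properDivisorProduct m Φ′                                        ≈⟨ foldr-filter (_∣? m) Φ′ (applyUpTo suc (m ∸ 1)) ⟩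
  foldr _⊗_ 1ₚ (map (λ d → select (d ∣? m) (Φ′ d)) (applyUpTo suc (m ∸ 1)))
                                                                  ≡⟨ foldr-applyUpTo (m ∸ 1) (λ d → select (d ∣? m) (Φ′ d)) id ⟩
  ∏ (m ∸ 1) (λ d → select (d ∣? m) (Φ′ d))
    ≈⟨ ∏-cong (m ∸ 1) (λ d 1≤d d≤m-1 → reflexive (cong (select (d ∣? m)) (cyclotomicUpTo-stable 1≤d d≤m-1))) ⟩
  ∏∣< m Φ                                                          ∎
  where
  open Mod-X^ N
  Φ′ = cyclotomicUpTo (m ∸ 1)

xPowMinusOne-≈-1 : ∀ {N} m → N ≤ m → xPowMinusOne m ≈[ N ] -1ₚ
xPowMinusOne-≈-1 {N} m N≤m = mk≈ λ k k<N → begin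
  coeff (monomial m ⊕ -1ₚ) k             ≡⟨ coeff-⊕ (monomial m) -1ₚ k ⟩
  coeff (monomial m) k ℤ.+ coeff -1ₚ k   ≡⟨ cong (ℤ._+ coeff -1ₚ k) (coeff-monomial-< (ℕ.<-≤-trans k<N N≤m)) ⟩
  + 0 ℤ.+ coeff -1ₚ k                    ≡⟨ ℤ.+-identityˡ _ ⟩
  coeff -1ₚ k                            ∎
  where open ≡-Reasoning

∏∣<Φ-unit : ∀ k → (∀ d → 1 ≤ d → d ≤ k → Φ d ⊗ Φ d ≈[ 1 ] 1ₚ) → ∏∣< (suc k) Φ ⊗ ∏∣< (suc k) Φ ≈[ 1 ] 1ₚ
∏∣<Φ-unit k Φ-unit = ∏-squares k λ d 1≤d d≤k → select-square (d ∣? suc k) (Φ-unit d 1≤d d≤k)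
  where open Mod-X^ 1

Φ-unit : ∀ m → 1 ≤ m → Φ m ⊗ Φ m ≈[ 1 ] 1ₚ
Φ-unit = <-rec _ step
  where
  open Mod-X^ 1
  step : ∀ m → (∀ {d} → d < m → 1 ≤ d → Φ d ⊗ Φ d ≈[ 1 ] 1ₚ) → 1 ≤ m → Φ m ⊗ Φ m ≈[ 1 ] 1ₚ
  step (suc k) IH _ = begin
    Φ (suc k) ⊗ Φ (suc k)          ≈⟨ ∙-cong Φ≈-P Φ≈-P ⟩
    (-1ₚ ⊗ P) ⊗ (-1ₚ ⊗ P)          ≈⟨ interchange -1ₚ P -1ₚ P ⟩
    (-1ₚ ⊗ -1ₚ) ⊗ (P ⊗ P)          ≈⟨ ∙-cong -1ₚ²≈1ₚ P²≈1 ⟩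
    1ₚ ⊗ 1ₚ                        ≈⟨ identityˡ 1ₚ ⟩
    1ₚ                             ∎
    where
    P = properDivisorProduct (suc k) (cyclotomicUpTo k)
    Φ≈-P : Φ (suc k) ≈[ 1 ] -1ₚ ⊗ P
    Φ≈-P = begin
      Φ (suc k)                                           ≡⟨ cyclotomic-suc k ⟩
      take (2 + k) (xPowMinusOne (suc k) ⊗ invSeries P (2 + k)) ≈⟨ ≈-weaken (s≤s z≤n) (take-≈ (2 + k) _) ⟩
      xPowMinusOne (suc k) ⊗ invSeries P (2 + k)          ≈⟨ ∙-cong (xPowMinusOne-≈-1 (suc k) (s≤s z≤n)) (invSeries-≈[1] P (2 + k) (s≤s z≤n)) ⟩
      -1ₚ ⊗ P                                             ∎
    P²≈1 : P ⊗ P ≈[ 1 ] 1ₚ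
    P²≈1 = ≈-trans (∙-cong (properDivisorProduct-≈ (suc k)) (properDivisorProduct-≈ (suc k)))
                   (∏∣<Φ-unit k λ d 1≤d d≤k → IH (s≤s d≤k) 1≤d)

∏∣Φ≈X^m-1 : ∀ m → 1 ≤ m → ∏∣ m Φ ≈[ suc m ] xPowMinusOne m
∏∣Φ≈X^m-1 (suc k) 1≤m = begin
  ∏∣ (suc k) Φ                  ≈⟨ ∏∣-proper Φ 1≤m ⟩
  ∏∣< (suc k) Φ ⊗ Φ (suc k)     ≈⟨ ∙-cong (≈-sym (properDivisorProduct-≈ (suc k))) (reflexive (cyclotomic-suc k)) ⟩
  P ⊗ take (2 + k) (D ⊗ P⁻¹)    ≈⟨ ⊗-congˡ P (take-≈ (2 + k) (D ⊗ P⁻¹)) ⟩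
  P ⊗ (D ⊗ P⁻¹)                 ≈⟨ x∙yz≈y∙xz P D P⁻¹ ⟩
  D ⊗ (P ⊗ P⁻¹)                 ≈⟨ ⊗-congˡ D (invSeries-inverse P (2 + k) P²≈1) ⟩
  D ⊗ 1ₚ                        ≈⟨ identityʳ D ⟩
  D                             ∎
  where
  open Mod-X^ (2 + k)
  P = properDivisorProduct (suc k) (cyclotomicUpTo k)
  D = xPowMinusOne (suc k)
  P⁻¹ = invSeries P (2 + k)
  P²≈1 : P ⊗ P ≈[ 1 ] 1ₚ
  P²≈1 = ≈-trans (⊗-cong (properDivisorProduct-≈ (suc k)) (properDivisorProduct-≈ (suc k)))
                 (∏∣<Φ-unit k λ d 1≤d _ → Φ-unit d 1≤d)

∏∣Φ≈-1 : ∀ {N n} → 1 ≤ n → N ≤ n → ∏∣ n Φ ≈[ N ] -1ₚ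
∏∣Φ≈-1 {n = n} 1≤n N≤n = ≈-trans (≈-weaken (ℕ.m≤n⇒m≤1+n N≤n) (∏∣Φ≈X^m-1 n 1≤n)) (xPowMinusOne-≈-1 n N≤n)

-- Φ 1 normalises to - + 1 ∷ + 1 ∷ [], that is X - 1.
coeff-Φ1⊗-zero : ∀ q → coeff (Φ 1 ⊗ q) 0 ≡ - coeff q 0
coeff-Φ1⊗-zero q = trans (coeff-⊗-zero (Φ 1) q) (ℤ.-1*i≡-i (coeff q 0))

coeff-Φ1⊗-suc : ∀ q k → coeff (Φ 1 ⊗ q) (suc k) ≡ coeff q k ℤ.- coeff q (suc k)
coeff-Φ1⊗-suc q k = begin
  coeff (Φ 1 ⊗ q) (suc k)                     ≡⟨ coeff-⊗-suc (Φ 1) q k ⟩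
  - + 1 ℤ.* coeff q (suc k) ℤ.+ coeff (1ₚ ⊗ q) k ≡⟨ cong₂ ℤ._+_ (ℤ.-1*i≡-i (coeff q (suc k))) (coeff-1ₚ-⊗ q k) ⟩
  - coeff q (suc k) ℤ.+ coeff q k              ≡⟨ ℤ.+-comm (- coeff q (suc k)) (coeff q k) ⟩
  coeff q k ℤ.- coeff q (suc k)                ∎
  where open ≡-Reasoning

coeff-geometric-sum : ∀ p → Φ 1 ⊗ ones p ≐ xPowMinusOne p
coeff-geometric-sum p zero    = trans (coeff-Φ1⊗-zero (ones p)) (constant p)
  where
  constant : ∀ p → - coeff (ones p) 0 ≡ coeff (xPowMinusOne p) 0
  constant zero    = refl
  constant (suc p) = refl
coeff-geometric-sum p (suc k) =
  trans (coeff-Φ1⊗-suc (ones p) k) (trans (telescope p k) (sym (trans (coeff-⊕ (monomial p) -1ₚ (suc k)) (ℤ.+-identityʳ _))))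
  where
  telescope : ∀ p k → coeff (ones p) k ℤ.- coeff (ones p) (suc k) ≡ coeff (monomial p) (suc k)
  telescope zero          k       = refl
  telescope (suc zero)    zero    = refl
  telescope (suc (suc p)) zero    = refl
  telescope (suc p)       (suc k) = telescope p k

geometric-sum : ∀ {N} p → Φ 1 ⊗ ones p ≈[ N ] xPowMinusOne p
geometric-sum p = ≐⇒≈ (coeff-geometric-sum p)

Φ-prime : ∀ {N p} → Prime p → Φ p ≈[ N ] ones p
Φ-prime {N} {p} p-prime with prime⇒≥2 p-prime
... | s≤s {n = m} _ = ≈-extend (length-Φ m) (ℕ.≤-trans (ℕ.≤-reflexive (length-replicate p)) (ℕ.n≤1+n p)) Φp≈ones
  where
  open Mod-X^ (suc p)
  Φ1⊗Φp≈Φ1⊗ones : Φ 1 ⊗ Φ p ≈[ suc p ] Φ 1 ⊗ ones p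
  Φ1⊗Φp≈Φ1⊗ones = begin
    Φ 1 ⊗ Φ p        ≈⟨ ∏∣-prime Φ p-prime ⟨
    ∏∣ p Φ           ≈⟨ ∏∣Φ≈X^m-1 p (ℕ.≤-trans (s≤s z≤n) (prime⇒≥2 p-prime)) ⟩
    xPowMinusOne p   ≈⟨ geometric-sum p ⟨
    Φ 1 ⊗ ones p     ∎
  Φp≈ones : Φ p ≈[ suc p ] ones p
  Φp≈ones = invertible-cancelˡ {x = Φ 1} {x⁻¹ = invSeries (Φ 1) (suc p)} (invSeries-inverse (Φ 1) (suc p) (Φ-unit 1 ℕ.≤-refl)) Φ1⊗Φp≈Φ1⊗ones

-- Coefficient computations

indicator : ∀ {p} {P : Set p} → Dec P → ℤ
indicator (yes _) = + 1
indicator (no _)  = + 0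

indicator-yes : ∀ {p} {P : Set p} (P? : Dec P) → P → indicator P? ≡ + 1
indicator-yes (yes _) _ = refl
indicator-yes (no ¬p) p = contradiction p ¬p

indicator-no : ∀ {p} {P : Set p} (P? : Dec P) → ¬ P → indicator P? ≡ + 0
indicator-no (yes p) ¬p = contradiction p ¬p
indicator-no (no _)  _  = refl

Xˢ-diag : ∀ a → Xˢ a a ≡ + 1
Xˢ-diag zero    = refl
Xˢ-diag (suc a) = Xˢ-diag a

Xˢ-off : ∀ {a k} → a ≢ k → Xˢ a k ≡ + 0
Xˢ-off {a} {k} a≢k rewrite dec-false (a ≟ k) a≢k = refl

coeff-monomial : ∀ a k → coeff (monomial a) k ≡ Xˢ a k
coeff-monomial zero    zero    = refl
coeff-monomial zero    (suc k) = refl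
coeff-monomial (suc a) zero    = refl
coeff-monomial (suc a) (suc k) = coeff-monomial a k

coeff-applyUpTo : ∀ f {M k} → k < M → coeff (applyUpTo f M) k ≡ f k
coeff-applyUpTo f {suc M} {zero}  _         = refl
coeff-applyUpTo f {suc M} {suc k} (s≤s k<M) = coeff-applyUpTo (f ∘ suc) k<M

coeff-monomial-⊗-low : ∀ a g {k} → k < a + 2 →
  coeff (monomial a ⊗ g) k ≡ Xˢ a k ℤ.* coeff g 0 ℤ.+ Xˢ (suc a) k ℤ.* coeff g 1
coeff-monomial-⊗-low a g {k} k<a+2 with k ℕ.<? a
... | yes k<a = begin
  coeff (monomial a ⊗ g) k                                  ≡⟨ coeff-monomial-⊗-< a g k<a ⟩
  + 0 ℤ.* coeff g 0 ℤ.+ + 0 ℤ.* coeff g 1                   ≡⟨ cong₂ (λ x y → x ℤ.* coeff g 0 ℤ.+ y ℤ.* coeff g 1)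
                                                                     (Xˢ-off (ℕ.>⇒≢ k<a)) (Xˢ-off (ℕ.>⇒≢ (ℕ.m<n⇒m<1+n k<a))) ⟨
  Xˢ a k ℤ.* coeff g 0 ℤ.+ Xˢ (suc a) k ℤ.* coeff g 1       ∎
  where open ≡-Reasoning
... | no k≮a = subst (λ k → coeff (monomial a ⊗ g) k ≡ Xˢ a k ℤ.* coeff g 0 ℤ.+ Xˢ (suc a) k ℤ.* coeff g 1)
                     (ℕ.m+[n∸m]≡n a≤k) (at (k ∸ a) (ℕ.+-cancelˡ-< a (k ∸ a) 2 (subst (_< a + 2) (sym (ℕ.m+[n∸m]≡n a≤k)) k<a+2)))
  where
  a≤k = ℕ.≮⇒≥ k≮a
  at : ∀ j → j < 2 → coeff (monomial a ⊗ g) (a + j) ≡ Xˢ a (a + j) ℤ.* coeff g 0 ℤ.+ Xˢ (suc a) (a + j) ℤ.* coeff g 1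
  at 0 _ = begin
    coeff (monomial a ⊗ g) (a + 0)                                   ≡⟨ coeff-monomial-⊗-+ a g 0 ⟩
    coeff g 0                                                        ≡⟨ trans (ℤ.+-identityʳ _) (ℤ.*-identityˡ _) ⟨
    + 1 ℤ.* coeff g 0 ℤ.+ + 0 ℤ.* coeff g 1                          ≡⟨ cong₂ (λ x y → x ℤ.* coeff g 0 ℤ.+ y ℤ.* coeff g 1)
                                                                              (trans (cong (Xˢ a) (ℕ.+-identityʳ a)) (Xˢ-diag a))
                                                                              (Xˢ-off (ℕ.>⇒≢ (ℕ.≤-reflexive (cong suc (ℕ.+-identityʳ a))))) ⟨
    Xˢ a (a + 0) ℤ.* coeff g 0 ℤ.+ Xˢ (suc a) (a + 0) ℤ.* coeff g 1   ∎
    where open ≡-Reasoning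
  at 1 _ = begin
    coeff (monomial a ⊗ g) (a + 1)                                   ≡⟨ coeff-monomial-⊗-+ a g 1 ⟩
    coeff g 1                                                        ≡⟨ trans (ℤ.+-identityˡ _) (ℤ.*-identityˡ _) ⟨
    + 0 ℤ.* coeff g 0 ℤ.+ + 1 ℤ.* coeff g 1                          ≡⟨ cong₂ (λ x y → x ℤ.* coeff g 0 ℤ.+ y ℤ.* coeff g 1)
                                                                              (Xˢ-off (ℕ.<⇒≢ (ℕ.m<m+n a (s≤s z≤n))))
                                                                              (trans (cong (Xˢ (suc a)) (ℕ.+-comm a 1)) (Xˢ-diag (suc a))) ⟨
    Xˢ a (a + 1) ℤ.* coeff g 0 ℤ.+ Xˢ (suc a) (a + 1) ℤ.* coeff g 1   ∎
    where open ≡-Reasoning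
  at (suc (suc j)) (s≤s (s≤s ()))

multiples : ℕ → ℕ → Poly
multiples p M = applyUpTo (λ k → indicator (p ∣? k)) M

1+X^_ : ℕ → Poly
1+X^ a = 1ₚ ⊕ monomial a

coeff-[-1ₚ]-pos : ∀ {k} → 1 ≤ k → coeff -1ₚ k ≡ + 0
coeff-[-1ₚ]-pos (s≤s _) = refl

xPowMinusOne⊗multiples : ∀ {p} M → 1 ≤ p → xPowMinusOne p ⊗ multiples p M ≈[ M ] -1ₚ
xPowMinusOne⊗multiples {p} M 1≤p = mk≈ λ k k<M → trans (coeff-xPowMinusOne-⊗ p S k) (at k k<M)
  where
  S = multiples p M
  s : ℕ → ℤ
  s k = indicator (p ∣? k)
  at : ∀ k → k < M → coeff (monomial p ⊗ S) k ℤ.- coeff S k ≡ coeff -1ₚ k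
  at k k<M with k ℕ.<? p
  ... | yes k<p = begin
    coeff (monomial p ⊗ S) k ℤ.- coeff S k   ≡⟨ cong₂ ℤ._-_ (coeff-monomial-⊗-< p S k<p) (coeff-applyUpTo s k<M) ⟩
    + 0 ℤ.- s k                              ≡⟨ ℤ.+-identityˡ _ ⟩
    - s k                                    ≡⟨ below k k<p ⟩
    coeff -1ₚ k                              ∎
    where
    open ≡-Reasoning
    below : ∀ k → k < p → - s k ≡ coeff -1ₚ k
    below zero    _   = cong -_ (indicator-yes (p ∣? 0) (p ∣0))
    below (suc k) k<p = cong -_ (indicator-no (p ∣? suc k) λ p∣k → ℕ.<⇒≱ k<p (∣⇒≤ p∣k))
  ... | no k≮p = begin
    coeff (monomial p ⊗ S) k ℤ.- coeff S k              ≡⟨ cong (λ i → coeff (monomial p ⊗ S) i ℤ.- coeff S i) (ℕ.m+[n∸m]≡n p≤k) ⟨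
    coeff (monomial p ⊗ S) (p + j) ℤ.- coeff S (p + j)
      ≡⟨ cong₂ ℤ._-_ (trans (coeff-monomial-⊗-+ p S j) (coeff-applyUpTo s (ℕ.≤-<-trans (ℕ.m∸n≤m k p) k<M)))
                                                                        (coeff-applyUpTo s (subst (_< M) (sym (ℕ.m+[n∸m]≡n p≤k)) k<M)) ⟩
    s j ℤ.- s (p + j)                                   ≡⟨ cong (ℤ._-_ (s j)) periodic ⟩
    s j ℤ.- s j                                         ≡⟨ ℤ.+-inverseʳ (s j) ⟩
    + 0                                                 ≡⟨ coeff-[-1ₚ]-pos (ℕ.≤-trans 1≤p p≤k) ⟨
    coeff -1ₚ k                                         ∎
    where
    open ≡-Reasoning
    p≤k = ℕ.≮⇒≥ k≮p
    j = k ∸ p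
    periodic : s (p + j) ≡ s j
    periodic with p ∣? j
    ... | yes p∣j = indicator-yes (p ∣? p + j) (∣m∣n⇒∣m+n ∣-refl p∣j)
    ... | no p∤j  = indicator-no (p ∣? p + j) λ p∣p+j → p∤j (∣m+n∣m⇒∣n p∣p+j ∣-refl)

coeff-1+X^ : ∀ a k → coeff (1+X^ a) k ≡ coeff 1ₚ k ℤ.+ Xˢ a k
coeff-1+X^ a k = trans (coeff-⊕ 1ₚ (monomial a) k) (cong (ℤ._+_ (coeff 1ₚ k)) (coeff-monomial a k))

1+X^⊗xPowMinusOne : ∀ {a} → 2 ≤ a → 1+X^ a ⊗ xPowMinusOne a ≈[ a + 2 ] -1ₚ
1+X^⊗xPowMinusOne {a} 2≤a = mk≈ λ k k<a+2 → begin
  coeff (E ⊗ xPowMinusOne a) k                                     ≡⟨ coeff-⊗-comm E (xPowMinusOne a) k ⟩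
  coeff (xPowMinusOne a ⊗ E) k                                     ≡⟨ coeff-xPowMinusOne-⊗ a E k ⟩
  coeff (monomial a ⊗ E) k ℤ.- coeff E k                           ≡⟨ cong₂ ℤ._-_ (coeff-monomial-⊗-low a E k<a+2) (coeff-1+X^ a k) ⟩
  Xˢ a k ℤ.* coeff E 0 ℤ.+ Xˢ (suc a) k ℤ.* coeff E 1 ℤ.- (coeff 1ₚ k ℤ.+ Xˢ a k)
      ≡⟨ cong₂ (λ x y → Xˢ a k ℤ.* x ℤ.+ Xˢ (suc a) k ℤ.* y ℤ.- (coeff 1ₚ k ℤ.+ Xˢ a k)) E₀≡1 E₁≡0 ⟩
  Xˢ a k ℤ.* + 1 ℤ.+ Xˢ (suc a) k ℤ.* + 0 ℤ.- (coeff 1ₚ k ℤ.+ Xˢ a k)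
                                                                   ≡⟨ cancel (Xˢ a k) (Xˢ (suc a) k) (coeff 1ₚ k) ⟩
  - coeff 1ₚ k                                                     ≡⟨ negate-1ₚ k ⟩
  coeff -1ₚ k                                                      ∎
  where
  open ≡-Reasoning
  E = 1+X^ a
  E₀≡1 : coeff E 0 ≡ + 1
  E₀≡1 = trans (coeff-1+X^ a 0) (cong (ℤ._+_ (+ 1)) (Xˢ-off (ℕ.>⇒≢ (ℕ.<-trans (s≤s z≤n) 2≤a))))
  E₁≡0 : coeff E 1 ≡ + 0
  E₁≡0 = trans (coeff-1+X^ a 1) (trans (ℤ.+-identityˡ _) (Xˢ-off (ℕ.>⇒≢ 2≤a)))
  cancel : ∀ x y c → x ℤ.* + 1 ℤ.+ y ℤ.* + 0 ℤ.- (c ℤ.+ x) ≡ - c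
  cancel = solve-∀
  negate-1ₚ : ∀ k → - coeff 1ₚ k ≡ coeff -1ₚ k
  negate-1ₚ zero    = refl
  negate-1ₚ (suc k) = refl

Σ<-zero : ∀ m {f} → (∀ i → i < m → f i ≡ + 0) → Σ< m f ≡ + 0
Σ<-zero zero    _    = refl
Σ<-zero (suc m) f≡0 = cong₂ ℤ._+_ (f≡0 0 (s≤s z≤n)) (Σ<-zero m λ i i<m → f≡0 (suc i) (s≤s i<m))

Σ<-single : ∀ m {f j} → j < m → f j ≡ + 1 → (∀ i → i < m → i ≢ j → f i ≡ + 0) → Σ< m f ≡ + 1
Σ<-single (suc m) {j = zero}  _         f0≡1 rest = cong₂ ℤ._+_ f0≡1 (Σ<-zero m λ i i<m → rest (suc i) (s≤s i<m) λ ())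
Σ<-single (suc m) {j = suc j} (s≤s j<m) fj≡1 rest =
  trans (cong₂ ℤ._+_ (rest 0 (s≤s z≤n) λ ()) (Σ<-single m j<m fj≡1 λ i i<m i≢j → rest (suc i) (s≤s i<m) (i≢j ∘ ℕ.suc-injective)))
        (ℤ.+-identityˡ _)

finSum≡Σ< : ∀ m e k → finSum m e k ≡ Σ< m (λ i → Xˢ (e i) k)
finSum≡Σ< m e k = cong (foldr ℤ._+_ (+ 0)) (map-applyUpTo id (λ i → Xˢ (e i) k) m)

finSum-hit : ∀ m e {k j} → j < m → e j ≡ k → (∀ i → e i ≡ k → i ≡ j) → finSum m e k ≡ + 1
finSum-hit m e {k} j<m ej≡k unique = trans (finSum≡Σ< m e k)
  (Σ<-single m j<m (trans (cong (λ x → Xˢ x k) ej≡k) (Xˢ-diag k)) λ i _ i≢j → Xˢ-off (i≢j ∘ unique i))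

finSum-miss : ∀ m e {k} → (∀ i → i < m → e i ≢ k) → finSum m e k ≡ + 0
finSum-miss m e {k} miss = trans (finSum≡Σ< m e k) (Σ<-zero m λ i i<m → Xˢ-off (miss i i<m))

coeff-ones-< : ∀ {p k} → k < p → coeff (ones p) k ≡ + 1
coeff-ones-< {suc p} {zero}  _         = refl
coeff-ones-< {suc p} {suc k} (s≤s k<p) = coeff-ones-< k<p

coeff-ones-≥ : ∀ {p k} → p ≤ k → coeff (ones p) k ≡ + 0
coeff-ones-≥ {p} p≤k = coeff-≥length (ones p) (subst (_≤ _) (sym (length-replicate p)) p≤k)

finSum-ones : ∀ p k → finSum p id k ≡ coeff (ones p) k
finSum-ones p k with k ℕ.<? p
... | yes k<p = trans (finSum-hit p id k<p refl λ _ i≡k → i≡k) (sym (coeff-ones-< k<p))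
... | no k≮p  = trans (finSum-miss p id λ i i<p i≡k → k≮p (subst (_< p) i≡k i<p)) (sym (coeff-ones-≥ (ℕ.≮⇒≥ k≮p)))

finSum-multiples : ∀ {p m k} → 1 ≤ p → k < m → finSum m (λ i → i * p) k ≡ indicator (p ∣? k)
finSum-multiples {p} {m} {k} 1≤p k<m with p ∣? k
... | yes (divides j k≡j*p) = finSum-hit m (λ i → i * p) (ℕ.≤-<-trans j≤k k<m) (sym k≡j*p)
                                λ i i*p≡k → ℕ.*-cancelʳ-≡ i j p (trans i*p≡k k≡j*p)
  where
  instance
    p≢0 : NonZero p
    p≢0 = >-nonZero 1≤p
  j≤k : j ≤ k
  j≤k = subst (j ≤_) (sym k≡j*p) (ℕ.m≤m*n j p)
... | no p∤k = finSum-miss m (λ i → i * p) λ i _ i*p≡k → p∤k (divides i (sym i*p≡k))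

infSum-multiples : ∀ {p} k → 1 ≤ p → infSum (λ i → i * p) k ≡ indicator (p ∣? k)
infSum-multiples k 1≤p = finSum-multiples 1≤p (ℕ.n<1+n k)

infSum-multiples+1-zero : ∀ p → infSum (λ i → i * p + 1) 0 ≡ + 0
infSum-multiples+1-zero p = finSum-miss 1 (λ i → i * p + 1) λ i _ → ℕ.m+1+n≢0 (i * p)

infSum-multiples+1-suc : ∀ {p} k → 1 ≤ p → infSum (λ i → i * p + 1) (suc k) ≡ indicator (p ∣? k)
infSum-multiples+1-suc {p} k 1≤p = begin
  finSum (2 + k) (λ i → i * p + 1) (suc k)         ≡⟨ finSum≡Σ< (2 + k) (λ i → i * p + 1) (suc k) ⟩
  Σ< (2 + k) (λ i → Xˢ (i * p + 1) (suc k))        ≡⟨ Σ<-cong (2 + k) (λ i _ → cong (λ x → Xˢ x (suc k)) (ℕ.+-comm (i * p) 1)) ⟩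
  Σ< (2 + k) (λ i → Xˢ (i * p) k)                  ≡⟨ finSum≡Σ< (2 + k) (λ i → i * p) k ⟨
  finSum (2 + k) (λ i → i * p) k                   ≡⟨ finSum-multiples 1≤p (ℕ.m<n⇒m<1+n (ℕ.n<1+n k)) ⟩
  indicator (p ∣? k)                               ∎
  where open ≡-Reasoning

-- The two smallest prime factors

alternate : ∀ {a} {A : Set a} → A → A → ℕ → A
alternate x y zero          = x
alternate x y (suc zero)    = y
alternate x y (suc (suc k)) = alternate x y k

alternate-even : ∀ {a} {A : Set a} (x y : A) {k} → 2 ∣ k → alternate x y k ≡ x
alternate-even x y {zero}          _     = refl
alternate-even x y {suc zero}      2∣1   = contradiction (∣1⇒≡1 2∣1) λ ()
alternate-even x y {suc (suc k)}   2∣2+k = alternate-even x y (∣m+n∣m⇒∣n 2∣2+k ∣-refl)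

alternate-odd : ∀ {a} {A : Set a} (x y : A) {k} → ¬ 2 ∣ k → alternate x y k ≡ y
alternate-odd x y {zero}          2∤0   = contradiction (2 ∣0) 2∤0
alternate-odd x y {suc zero}      _     = refl
alternate-odd x y {suc (suc k)}   2∤2+k = alternate-odd x y (2∤2+k ∘ ∣m∣n⇒∣m+n ∣-refl)

module TwoPrimes {p₁ p₂} (p₁-prime : Prime p₁) (p₂-prime : Prime p₂) (p₁<p₂ : p₁ < p₂) where

  N : ℕ
  N = p₂ + 2

  S E A B : Poly
  S = multiples p₁ N
  E = 1+X^ p₂
  A = (-1ₚ ⊗ Φ 1) ⊗ (S ⊗ E)
  B = ones p₁ ⊗ (-1ₚ ⊗ xPowMinusOne p₂)

  1<N : 1 < N
  1<N = ℕ.m≤n+m 2 p₂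

  2≤p₁ : 2 ≤ p₁
  2≤p₁ = prime⇒≥2 p₁-prime

  2≤p₂ : 2 ≤ p₂
  2≤p₂ = prime⇒≥2 p₂-prime

  [X-1]ones⊗S≈-1 : (Φ 1 ⊗ ones p₁) ⊗ S ≈[ N ] -1ₚ
  [X-1]ones⊗S≈-1 = ≈-trans (⊗-congʳ S (geometric-sum p₁)) (xPowMinusOne⊗multiples N (ℕ.<⇒≤ 2≤p₁))

  E⊗[X-1]ones≈-1 : E ⊗ (Φ 1 ⊗ ones p₂) ≈[ N ] -1ₚ
  E⊗[X-1]ones≈-1 = ≈-trans (⊗-congˡ E (geometric-sum p₂)) (1+X^⊗xPowMinusOne 2≤p₂)

  Φ[p₁p₂]-relation : (Φ 1 ⊗ ones p₂) ⊗ (ones p₁ ⊗ Φ (p₁ * p₂)) ≈[ N ] -1ₚ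
  Φ[p₁p₂]-relation = begin
    (Φ 1 ⊗ ones p₂) ⊗ (ones p₁ ⊗ Φ (p₁ * p₂))          ≈⟨ ∙-cong (⊗-congˡ (Φ 1) (Φ-prime p₂-prime)) (⊗-congʳ (Φ (p₁ * p₂)) (Φ-prime p₁-prime)) ⟨
    (Φ 1 ⊗ Φ p₂) ⊗ (Φ p₁ ⊗ Φ (p₁ * p₂))                ≡⟨ cong (λ d → (Φ 1 ⊗ Φ p₂) ⊗ (Φ d ⊗ Φ (p₁ * p₂))) (ℕ.*-identityʳ p₁) ⟨
    (Φ 1 ⊗ Φ p₂) ⊗ (Φ (p₁ * 1) ⊗ Φ (p₁ * p₂))          ≈⟨ ∙-cong (∏∣-prime Φ p₂-prime) (∏∣-prime (λ d → Φ (p₁ * d)) p₂-prime) ⟨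
    ∏∣ p₂ Φ ⊗ ∏∣ p₂ (λ d → Φ (p₁ * d))                 ≈⟨ ∏∣-*-prime Φ p₁-prime p₁∤p₂ (ℕ.<⇒≤ 2≤p₂) ⟨
    ∏∣ (p₁ * p₂) Φ                                      ≈⟨ ∏∣Φ≈-1 (ℕ.≤-trans (ℕ.<⇒≤ 2≤p₂) p₂≤p₁p₂) (ℕ.≤-trans N≤2p₂ (ℕ.*-monoˡ-≤ p₂ 2≤p₁)) ⟩
    -1ₚ                                                 ∎
    where
    open Mod-X^ N
    p₁∤p₂ : ¬ p₁ ∣ p₂
    p₁∤p₂ p₁∣p₂ = case prime⇒irreducible p₂-prime p₁∣p₂ of λ
      { (inj₁ p₁≡1) → ℕ.<⇒≢ 2≤p₁ (sym p₁≡1)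
      ; (inj₂ p₁≡p₂) → ℕ.<⇒≢ p₁<p₂ p₁≡p₂ }
    p₂≤p₁p₂ : p₂ ≤ p₁ * p₂
    p₂≤p₁p₂ = ℕ.m≤n*m p₂ p₁ {{>-nonZero (ℕ.<⇒≤ 2≤p₁)}}
    N≤2p₂ : N ≤ 2 * p₂
    N≤2p₂ = ℕ.≤-trans (ℕ.+-monoʳ-≤ p₂ 2≤p₂) (ℕ.≤-reflexive (cong (_+_ p₂) (sym (ℕ.+-identityʳ p₂))))

  -- Multiply by (-1)² = ((X-1)(1+⋯+X^{p₁-1}) S) (E (X-1)(1+⋯+X^{p₂-1})) and regroup around the relation.
  Φ[p₁p₂]≈A : Φ (p₁ * p₂) ≈[ N ] A
  Φ[p₁p₂]≈A = begin
    U                                                               ≈⟨ identityʳ U ⟨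
    U ⊗ 1ₚ                                                          ≈⟨ ⊗-congˡ U -1ₚ²≈1ₚ ⟨
    U ⊗ (-1ₚ ⊗ -1ₚ)                                                 ≈⟨ ⊗-congˡ U (∙-cong [X-1]ones⊗S≈-1 E⊗[X-1]ones≈-1) ⟨
    U ⊗ (((Φ 1 ⊗ ones p₁) ⊗ S) ⊗ (E ⊗ (Φ 1 ⊗ ones p₂)))             ≈⟨ regroup U (Φ 1) (ones p₁) (ones p₂) S E ⟩
    (((Φ 1 ⊗ ones p₂) ⊗ (ones p₁ ⊗ U)) ⊗ Φ 1) ⊗ (S ⊗ E)              ≈⟨ ⊗-congʳ (S ⊗ E) (⊗-congʳ (Φ 1) Φ[p₁p₂]-relation) ⟩
    A                                                               ∎
    where
    open Mod-X^ N
    open import Algebra.Solver.CommutativeMonoid (⊗-commutativeMonoid N) using (solve; _⊜_) renaming (_⊕_ to _⊛_)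
    U = Φ (p₁ * p₂)
    regroup : ∀ u f o₁ o₂ s e → u ⊗ (((f ⊗ o₁) ⊗ s) ⊗ (e ⊗ (f ⊗ o₂))) ≈[ N ] (((f ⊗ o₂) ⊗ (o₁ ⊗ u)) ⊗ f) ⊗ (s ⊗ e)
    regroup = solve 6 (λ u f o₁ o₂ s e → u ⊛ (((f ⊛ o₁) ⊛ s) ⊛ (e ⊛ (f ⊛ o₂))) ⊜ (((f ⊛ o₂) ⊛ (o₁ ⊛ u)) ⊛ f) ⊛ (s ⊛ e)) ≈-refl

  A⊗B≈1 : A ⊗ B ≈[ N ] 1ₚ
  A⊗B≈1 = begin
    A ⊗ B                                                           ≈⟨ regroup -1ₚ (Φ 1) (ones p₁) S E (xPowMinusOne p₂) ⟩
    (-1ₚ ⊗ -1ₚ) ⊗ (((Φ 1 ⊗ ones p₁) ⊗ S) ⊗ (E ⊗ xPowMinusOne p₂))    ≈⟨ ∙-cong -1ₚ²≈1ₚ (∙-cong [X-1]ones⊗S≈-1 (1+X^⊗xPowMinusOne 2≤p₂)) ⟩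
    1ₚ ⊗ (-1ₚ ⊗ -1ₚ)                                                ≈⟨ identityˡ _ ⟩
    -1ₚ ⊗ -1ₚ                                                       ≈⟨ -1ₚ²≈1ₚ ⟩
    1ₚ                                                              ∎
    where
    open Mod-X^ N
    open import Algebra.Solver.CommutativeMonoid (⊗-commutativeMonoid N) using (solve; _⊜_) renaming (_⊕_ to _⊛_)
    regroup : ∀ n f o s e d → ((n ⊗ f) ⊗ (s ⊗ e)) ⊗ (o ⊗ (n ⊗ d)) ≈[ N ] (n ⊗ n) ⊗ (((f ⊗ o) ⊗ s) ⊗ (e ⊗ d))
    regroup = solve 6 (λ n f o s e d → ((n ⊛ f) ⊛ (s ⊛ e)) ⊛ (o ⊛ (n ⊛ d)) ⊜ (n ⊛ n) ⊛ (((f ⊛ o) ⊛ s) ⊛ (e ⊛ d))) ≈-refl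

  s : ℕ → ℤ
  s k = indicator (p₁ ∣? k)

  coeff-S⊗E : ∀ {k} → k < N → coeff (S ⊗ E) k ≡ s k ℤ.+ Xˢ p₂ k
  coeff-S⊗E {k} k<N = begin
    coeff (S ⊗ E) k                                       ≡⟨ coeff-⊗-comm S E k ⟩
    coeff ((1ₚ ⊕ monomial p₂) ⊗ S) k                      ≡⟨ coeff-⊕-⊗ 1ₚ (monomial p₂) S k ⟩
    coeff (1ₚ ⊗ S) k ℤ.+ coeff (monomial p₂ ⊗ S) k
      ≡⟨ cong₂ ℤ._+_ (trans (coeff-1ₚ-⊗ S k) (coeff-applyUpTo s k<N)) (coeff-monomial-⊗-low p₂ S k<N) ⟩
    s k ℤ.+ (Xˢ p₂ k ℤ.* coeff S 0 ℤ.+ Xˢ (suc p₂) k ℤ.* coeff S 1)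
                                                          ≡⟨ cong₂ (λ x y → s k ℤ.+ (Xˢ p₂ k ℤ.* x ℤ.+ Xˢ (suc p₂) k ℤ.* y)) s₀≡1 s₁≡0 ⟩
    s k ℤ.+ (Xˢ p₂ k ℤ.* + 1 ℤ.+ Xˢ (suc p₂) k ℤ.* + 0)
      ≡⟨ cong (ℤ._+_ (s k)) (trans (cong₂ ℤ._+_ (ℤ.*-identityʳ (Xˢ p₂ k)) (ℤ.*-zeroʳ (Xˢ (suc p₂) k))) (ℤ.+-identityʳ (Xˢ p₂ k))) ⟩
    s k ℤ.+ Xˢ p₂ k                                       ∎
    where
    open ≡-Reasoning
    s₀≡1 : coeff S 0 ≡ + 1
    s₀≡1 = trans (coeff-applyUpTo s (ℕ.<-trans (s≤s z≤n) 1<N)) (indicator-yes (p₁ ∣? 0) (p₁ ∣0))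
    s₁≡0 : coeff S 1 ≡ + 0
    s₁≡0 = trans (coeff-applyUpTo s 1<N) (indicator-no (p₁ ∣? 1) λ p₁∣1 → ℕ.<⇒≢ 2≤p₁ (sym (∣1⇒≡1 p₁∣1)))

  Xˢ[p₂+1] : ∀ k → Xˢ (p₂ + 1) k ≡ Xˢ (suc p₂) k
  Xˢ[p₂+1] k = cong (λ e → Xˢ e k) (ℕ.+-comm p₂ 1)

  A-coeffs : toSeries A ≡ infSum (λ i → i * p₁) -ₛ infSum (λ i → i * p₁ + 1) +ₛ Xˢ p₂ -ₛ Xˢ (p₂ + 1) mod-X^ N
  A-coeffs zero    0<N = begin
    coeff A 0                                     ≡⟨ coeff-⊗-zero (-1ₚ ⊗ Φ 1) (S ⊗ E) ⟩
    + 1 ℤ.* coeff (S ⊗ E) 0                       ≡⟨ trans (ℤ.*-identityˡ _) (coeff-S⊗E 0<N) ⟩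
    s 0 ℤ.+ Xˢ p₂ 0                               ≡⟨ rearrange (s 0) (Xˢ p₂ 0) ⟩
    s 0 ℤ.- + 0 ℤ.+ Xˢ p₂ 0 ℤ.- + 0
      ≡⟨ cong₂ (λ x y → x ℤ.- y ℤ.+ Xˢ p₂ 0 ℤ.- + 0) (infSum-multiples 0 1≤p₁) (infSum-multiples+1-zero p₁) ⟨
    infSum (λ i → i * p₁) 0 ℤ.- infSum (λ i → i * p₁ + 1) 0 ℤ.+ Xˢ p₂ 0 ℤ.- + 0
                                                  ≡⟨ cong (ℤ._-_ (infSum (λ i → i * p₁) 0 ℤ.- infSum (λ i → i * p₁ + 1) 0 ℤ.+ Xˢ p₂ 0))
                                                          (Xˢ-off (ℕ.m+1+n≢0 p₂)) ⟨
    infSum (λ i → i * p₁) 0 ℤ.- infSum (λ i → i * p₁ + 1) 0 ℤ.+ Xˢ p₂ 0 ℤ.- Xˢ (p₂ + 1) 0 ∎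
    where
    open ≡-Reasoning
    1≤p₁ = ℕ.<⇒≤ 2≤p₁
    rearrange : ∀ x y → x ℤ.+ y ≡ x ℤ.- + 0 ℤ.+ y ℤ.- + 0
    rearrange = solve-∀
  A-coeffs (suc k) k<N = begin
    coeff A (suc k)                                          ≡⟨ coeff-⊗-assoc -1ₚ (Φ 1) (S ⊗ E) (suc k) ⟩
    coeff (-1ₚ ⊗ (Φ 1 ⊗ (S ⊗ E))) (suc k)                    ≡⟨ coeff-[-1ₚ]⊗ (Φ 1 ⊗ (S ⊗ E)) (suc k) ⟩
    - coeff (Φ 1 ⊗ (S ⊗ E)) (suc k)                          ≡⟨ cong -_ (coeff-Φ1⊗-suc (S ⊗ E) k) ⟩
    - (coeff (S ⊗ E) k ℤ.- coeff (S ⊗ E) (suc k))            ≡⟨ cong₂ (λ x y → - (x ℤ.- y)) (coeff-S⊗E (ℕ.<-trans (ℕ.n<1+n k) k<N)) (coeff-S⊗E k<N) ⟩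
    - (s k ℤ.+ Xˢ p₂ k ℤ.- (s (suc k) ℤ.+ Xˢ p₂ (suc k)))    ≡⟨ rearrange (s k) (Xˢ p₂ k) (s (suc k)) (Xˢ p₂ (suc k)) ⟩
    s (suc k) ℤ.- s k ℤ.+ Xˢ p₂ (suc k) ℤ.- Xˢ p₂ k          ≡⟨ cong₂ (λ x y → x ℤ.- y ℤ.+ Xˢ p₂ (suc k) ℤ.- Xˢ p₂ k)
                                                                      (infSum-multiples (suc k) 1≤p₁) (infSum-multiples+1-suc k 1≤p₁) ⟨
    infSum (λ i → i * p₁) (suc k) ℤ.- infSum (λ i → i * p₁ + 1) (suc k) ℤ.+ Xˢ p₂ (suc k) ℤ.- Xˢ p₂ k
      ≡⟨ cong (ℤ._-_ (infSum (λ i → i * p₁) (suc k) ℤ.- infSum (λ i → i * p₁ + 1) (suc k) ℤ.+ Xˢ p₂ (suc k)))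
                                                                     (Xˢ[p₂+1] (suc k)) ⟨
    infSum (λ i → i * p₁) (suc k) ℤ.- infSum (λ i → i * p₁ + 1) (suc k) ℤ.+ Xˢ p₂ (suc k) ℤ.- Xˢ (p₂ + 1) (suc k) ∎
    where
    open ≡-Reasoning
    1≤p₁ = ℕ.<⇒≤ 2≤p₁
    rearrange : ∀ a x b y → - (a ℤ.+ x ℤ.- (b ℤ.+ y)) ≡ b ℤ.- a ℤ.+ y ℤ.- x
    rearrange = solve-∀

  B-coeffs : toSeries B ≡ finSum p₁ (λ i → i) -ₛ Xˢ p₂ -ₛ Xˢ (p₂ + 1) mod-X^ N
  B-coeffs k k<N = begin
    coeff B k                                                  ≡⟨ coeff-⊗-comm (ones p₁) (-1ₚ ⊗ D) k ⟩
    coeff ((-1ₚ ⊗ D) ⊗ ones p₁) k                              ≡⟨ coeff-⊗-assoc -1ₚ D (ones p₁) k ⟩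
    coeff (-1ₚ ⊗ (D ⊗ ones p₁)) k                              ≡⟨ coeff-[-1ₚ]⊗ (D ⊗ ones p₁) k ⟩
    - coeff (D ⊗ ones p₁) k                                    ≡⟨ cong -_ (coeff-xPowMinusOne-⊗ p₂ (ones p₁) k) ⟩
    - (coeff (monomial p₂ ⊗ ones p₁) k ℤ.- coeff (ones p₁) k)  ≡⟨ cong (λ x → - (x ℤ.- coeff (ones p₁) k)) (coeff-monomial-⊗-low p₂ (ones p₁) k<N) ⟩
    - (Xˢ p₂ k ℤ.* coeff (ones p₁) 0 ℤ.+ Xˢ (suc p₂) k ℤ.* coeff (ones p₁) 1 ℤ.- coeff (ones p₁) k)
                                                               ≡⟨ cong₂ (λ x y → - (Xˢ p₂ k ℤ.* x ℤ.+ Xˢ (suc p₂) k ℤ.* y ℤ.- coeff (ones p₁) k))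
                                                                        (coeff-ones-< (ℕ.<-trans (s≤s z≤n) 2≤p₁)) (coeff-ones-< 2≤p₁) ⟩
    - (Xˢ p₂ k ℤ.* + 1 ℤ.+ Xˢ (suc p₂) k ℤ.* + 1 ℤ.- coeff (ones p₁) k)
                                                               ≡⟨ rearrange (Xˢ p₂ k) (Xˢ (suc p₂) k) (coeff (ones p₁) k) ⟩
    coeff (ones p₁) k ℤ.- Xˢ p₂ k ℤ.- Xˢ (suc p₂) k            ≡⟨ cong₂ (λ x y → x ℤ.- Xˢ p₂ k ℤ.- y) (finSum-ones p₁ k) (Xˢ[p₂+1] k) ⟨
    finSum p₁ (λ i → i) k ℤ.- Xˢ p₂ k ℤ.- Xˢ (p₂ + 1) k        ∎
    where
    open ≡-Reasoning
    D = xPowMinusOne p₂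
    rearrange : ∀ x y c → - (x ℤ.* + 1 ℤ.+ y ℤ.* + 1 ℤ.- c) ≡ c ℤ.- x ℤ.- y
    rearrange = solve-∀

  alternate-inverse : ∀ k → alternate A B k ⊗ alternate A B (suc k) ≈[ N ] 1ₚ
  alternate-inverse zero          = A⊗B≈1
  alternate-inverse (suc zero)    = ≈-trans (≐⇒≈ (coeff-⊗-comm B A)) A⊗B≈1
  alternate-inverse (suc (suc k)) = alternate-inverse k

  Φ-tower : ∀ qs → All Prime qs → All (N ≤_) qs → AllPairs _<_ (p₂ ∷ qs) →
            Φ (p₁ * (p₂ * product qs)) ≈[ N ] alternate A B (length qs)
  Φ-tower [] [] [] _ = subst (λ m → Φ (p₁ * m) ≈[ N ] A) (sym (ℕ.*-identityʳ p₂)) Φ[p₁p₂]≈A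
  Φ-tower (q ∷ qs) (q-prime ∷ qs-prime) (N≤q ∷ N≤qs) ((p₂<q ∷ p₂<qs) ∷ q<qs ∷ ordered) =
    subst (λ n → Φ n ≈[ N ] alternate A B (suc (length qs))) (sym reorder) Φ[q*m]≈alternate
    where
    open Mod-X^ N
    m = p₁ * (p₂ * product qs)
    reorder : p₁ * (p₂ * (q * product qs)) ≡ q * m
    reorder = trans (cong (p₁ *_) (ℕ*.x∙yz≈y∙xz p₂ q (product qs))) (ℕ*.x∙yz≈y∙xz p₁ q (p₂ * product qs))
    q∤m : ¬ q ∣ m
    q∤m = prime∤product q-prime (p₁-prime ∷ p₂-prime ∷ qs-prime)
            (ℕ.<⇒≢ (ℕ.<-trans p₁<p₂ p₂<q) ∷ ℕ.<⇒≢ p₂<q ∷ All.map ℕ.>⇒≢ q<qs)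
    2≤m : 2 ≤ m
    2≤m = ℕ.≤-trans 2≤p₁ (ℕ.m≤m*n p₁ (p₂ * product qs) {{productOfPrimes≢0 (p₂-prime ∷ qs-prime)}})
    Φm⊗Φ[q*m]≈1 : Φ m ⊗ Φ (q * m) ≈[ N ] 1ₚ
    Φm⊗Φ[q*m]≈1 = Fm∙F[q*m]≈ε {c = -1ₚ} {F = Φ} -1ₚ²≈1ₚ (λ _ → ∏∣Φ≈-1) q-prime N≤q m 2≤m q∤m
    Φm⊗alternate≈1 : Φ m ⊗ alternate A B (suc (length qs)) ≈[ N ] 1ₚ
    Φm⊗alternate≈1 = ≈-trans (⊗-congʳ _ (Φ-tower qs qs-prime N≤qs (p₂<qs ∷ ordered))) (alternate-inverse (length qs))
    Φ[q*m]≈alternate : Φ (q * m) ≈[ N ] alternate A B (suc (length qs))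
    Φ[q*m]≈alternate = inverse-unique {x = Φ m} Φm⊗Φ[q*m]≈1 Φm⊗alternate≈1

lemma2p1 : (n : ℕ) → ¬ (2 ∣ n) → (∀ d → d * d ∣ n → d ≡ 1) → Composite n →
    (p₁ p₂ : ℕ) (ps : List ℕ) →
    All Prime (p₁ ∷ p₂ ∷ ps) → Linked _<_ (p₁ ∷ p₂ ∷ ps) → product (p₁ ∷ p₂ ∷ ps) ≡ n →
    (¬ (2 ∣ length (p₁ ∷ p₂ ∷ ps)) →
      toSeries (cyclotomic n)
        ≡ finSum p₁ (λ i → i) -ₛ Xˢ p₂ -ₛ Xˢ (p₂ + 1)
        mod-X^ (p₂ + 2))
    × (2 ∣ length (p₁ ∷ p₂ ∷ ps) →
      toSeries (cyclotomic n)
        ≡ infSum (λ i → i * p₁) -ₛ infSum (λ i → i * p₁ + 1) +ₛ Xˢ p₂ -ₛ Xˢ (p₂ + 1)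
        mod-X^ (p₂ + 2))
-- Square-freeness and compositeness of n are already encoded in the sorted list of primes.
lemma2p1 _ 2∤n _ _ p₁ p₂ ps (p₁-prime ∷ p₂-prime ∷ ps-prime) sorted refl =
  (λ 2∤t → ≈-toSeries (subst (Φ n ≈[ N ]_) (alternate-odd A B 2∤t) Φn≈) B-coeffs) ,
  (λ 2∣t → ≈-toSeries (subst (Φ n ≈[ N ]_) (alternate-even A B 2∣t) Φn≈) A-coeffs)
  where
  n = product (p₁ ∷ p₂ ∷ ps)
  ordered : AllPairs _<_ (p₁ ∷ p₂ ∷ ps)
  ordered = Linked⇒AllPairs ℕ.<-trans sorted
  p₁<p₂ : p₁ < p₂
  p₁<p₂ with ordered
  ... | (p₁<p₂ ∷ _) ∷ _ = p₁<p₂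
  open TwoPrimes p₁-prime p₂-prime p₁<p₂
  odd : All (λ p → ¬ 2 ∣ p) (p₁ ∷ p₂ ∷ ps)
  odd = All.tabulate λ p∈ 2∣p → 2∤n (∣-trans 2∣p (∈⇒∣product p∈))
  Φn≈ : Φ n ≈[ N ] alternate A B (length (p₁ ∷ p₂ ∷ ps))
  Φn≈ with ordered | odd
  ... | _ ∷ p₂<ps ∷ ps-ordered | _ ∷ 2∤p₂ ∷ 2∤ps =
    Φ-tower ps ps-prime (All.zipWith N≤q (2∤ps , p₂<ps)) (p₂<ps ∷ ps-ordered)
    where
    N≤q : ∀ {q} → ¬ 2 ∣ q × p₂ < q → N ≤ q
    N≤q (2∤q , p₂<q) = ℕ.≤-trans (ℕ.≤-reflexive (ℕ.+-comm p₂ 2)) (odd<odd⇒2+≤ 2∤p₂ 2∤q p₂<q)
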